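{- Let $V_{a,b,n,(u_i)_1^n}$ and $V_{a',b',n,(u'_i)_1^n}$ be dented half-hexagons (with $a,a',b,b',n$ nonnegative integers, $1\le u_1<\dots<u_n\le b+2n$ and $1\le u'_1<\dots<u'_n\le b'+2n$) such that $u_i\le u'_i$ for all $i\in\{1,\dots,n\}$. If $V_{a,b,n,(u_i)_1^n}$ has a lozenge tiling, then so does $V_{a',b',n,(u'_i)_1^n}$.
   Context: Work on the triangular lattice of the plane with some lattice lines horizontal; its unit equilateral triangles are called triangles. A lozenge is the union of two triangles sharing an edge; a lozenge tiling of a region (a union of triangles) is a covering of it by lozenges contained in it with pairwise disjoint interiors. $H_{a,b,c,t}$ is the equiangular hexagonal region with side lengths $a,b+t,c,a+t,b,c+t$ read clockwise from the northern (horizontal) side. For $1\le u_1<\dots<u_m\le b+t$ and $1\le v_1<\dots<v_k\le c+t$, $H_{a,b,c,t,(u_i)_1^m,(v_j)_1^k}$ is obtained from $H_{a,b,c,t}$ by removing the $u_i$-th triangle along the northeast side (counting from the north the triangles sharing an edge with that side) for each $i$, and the $v_j$-th triangle along the northwest side (counted likewise) for each $j$. For nonnegative integers $a,b,n$ and $1\le u_1<\dots<u_n\le b+2n$, the region $H_{2a,b,b,2n,(u_i)_1^n,(u_i)_1^n}$ is symmetric about a vertical line $L$, and the dented half-hexagon $V_{a,b,n,(u_i)_1^n}$ is the region consisting of the triangles of this hexagon whose interiors lie strictly west of $L$. -}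

module Defs where

open import Data.Nat using (ℕ; zero; suc; _+_; _*_; _≤_; _<_; _≡ᵇ_)
open import Data.Bool using (Bool; true; false; _∧_; _∨_; if_then_else_)
open import Data.Fin using (Fin)
import Data.Fin as F
open import Data.List using (List; []; _∷_)
open import Data.List.Relation.Unary.All using (All)
open import Data.Product using (Σ; Σ-syntax; _×_; _,_; proj₁; proj₂)
open import Relation.Binary.PropositionalEquality using (_≡_)
open import Relation.Nullary using (¬_)

-- Triangular lattice: vertices are integer combinations x·e₁ + y·e₂ with
-- e₁ = (1,0), e₂ = (1/2, √3/2).  (Cartesian point: (x + y/2, y·√3/2).)
-- up   X y : triangle with vertices (X,y), (X+1,y), (X,y+1)
-- down X y : triangle with vertices (X+1,y), (X,y+1), (X+1,y+1)
-- All regions considered here live in the quadrant X ≥ 0, y ≥ 0.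

data Orient : Set where
  up down : Orient

record Tri : Set where
  constructor tri
  field
    ori : Orient
    px  : ℕ
    py  : ℕ
open Tri public

ori≡ᵇ : Orient → Orient → Bool
ori≡ᵇ up up = true
ori≡ᵇ down down = true
ori≡ᵇ _ _ = false

tri≡ᵇ : Tri → Tri → Bool
tri≡ᵇ (tri o x y) (tri o' x' y') = ori≡ᵇ o o' ∧ ((x ≡ᵇ x') ∧ (y ≡ᵇ y'))

-- Lozenges: every pair of edge-adjacent triangles (in the quadrant).
--   lozA X y = up X y ∪ down X y        (common edge (X+1,y)–(X,y+1))
--   lozB X y = up (X+1) y ∪ down X y    (common edge (X+1,y)–(X+1,y+1))
--   lozC X y = up X (y+1) ∪ down X y    (common edge (X,y+1)–(X+1,y+1))
data Loz : Set where
  lozA lozB lozC : ℕ → ℕ → Loz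

trisOf : Loz → Tri × Tri
trisOf (lozA x y) = tri up x y , tri down x y
trisOf (lozB x y) = tri up (suc x) y , tri down x y
trisOf (lozC x y) = tri up x (suc y) , tri down x y

covers : Loz → Tri → Bool
covers l τ = tri≡ᵇ (proj₁ (trisOf l)) τ ∨ tri≡ᵇ (proj₂ (trisOf l)) τ

coverCount : Tri → List Loz → ℕ
coverCount τ [] = 0
coverCount τ (l ∷ ls) = (if covers l τ then 1 else 0) + coverCount τ ls

Region : Set₁
Region = Tri → Set

-- A lozenge tiling: a finite family of lozenges, each contained in R,
-- covering every triangle of R exactly once (hence pairwise disjoint interiors).
LozengeTiling : Region → Set
LozengeTiling R =
  Σ[ ls ∈ List Loz ]
    (All (λ l → R (proj₁ (trisOf l)) × R (proj₂ (trisOf l))) ls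
     × (∀ τ → R τ → coverCount τ ls ≡ 1))

-- Hexagon H_{a,b,c,t}: sides a, b+t, c, a+t, b, c+t clockwise from north.
-- Placed (in coordinates (X,y)) with corners
--   (0,h) (a,h) (a+b+t,c) (a+b+t,0) (b,0) (0,b),   h = b+c+t,
-- i.e. the convex set 0 ≤ y ≤ h, 0 ≤ X ≤ a+b+t, b ≤ X+y ≤ a+b+c+t.
-- A triangle belongs to it iff its three vertices do.
inHex : ℕ → ℕ → ℕ → ℕ → Tri → Set
inHex a b c t (tri up X y) =
  (y + 1 ≤ b + c + t) × (X + 1 ≤ a + b + t) × (b ≤ X + y) × (X + y + 1 ≤ a + b + c + t)
inHex a b c t (tri down X y) =
  (y + 1 ≤ b + c + t) × (X + 1 ≤ a + b + t) × (b ≤ X + y + 1) × (X + y + 2 ≤ a + b + c + t)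

-- The i-th triangle (counted from the north, i ≥ 1) along the northeast side
-- (the line X+y = a+b+c+t) is  up (a+i-1) (h-i);
-- the j-th triangle along the northwest side (the line X = 0) is up 0 (h-j).
NEdent : ℕ → ℕ → ℕ → ℕ → ℕ → Tri → Set
NEdent a b c t i τ = (ori τ ≡ up) × (px τ + 1 ≡ a + i) × (py τ + i ≡ b + c + t)

NWdent : ℕ → ℕ → ℕ → ℕ → ℕ → Tri → Set
NWdent a b c t j τ = (ori τ ≡ up) × (px τ ≡ 0) × (py τ + j ≡ b + c + t)

dentedHex : (a b c t m k : ℕ) → (Fin m → ℕ) → (Fin k → ℕ) → Region
dentedHex a b c t m k u v τ =
  inHex a b c t τ
  × (¬ (Σ[ i ∈ Fin m ] NEdent a b c t (u i) τ))
  × (¬ (Σ[ j ∈ Fin k ] NWdent a b c t (v j) τ))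

-- Triangles whose interior lies strictly west of the vertical symmetry line L
-- of H_{2a,b,b,2n}.  L is the line with Cartesian abscissa (in these coordinates)
-- X - b + y/2 = a + n, i.e. 2X + y = 2(a+n+b).
-- up X y spans abscissae [X-b+y/2, X-b+y/2+1];
-- down X y spans [X-b+y/2+1/2, X-b+y/2+3/2].
westOfL : ℕ → ℕ → ℕ → Tri → Set
westOfL a b n (tri up X y)   = 2 * X + y + 2 ≤ 2 * (a + n + b)
westOfL a b n (tri down X y) = 2 * X + y + 3 ≤ 2 * (a + n + b)

V : (a b n : ℕ) → (Fin n → ℕ) → Region
V a b n u τ = dentedHex (2 * a) b b (2 * n) n n u u τ × westOfL a b n τ

ValidDents : (n bound : ℕ) → (Fin n → ℕ) → Set
ValidDents n bound u =
  (∀ i → 1 ≤ u i) × (∀ i → u i ≤ bound) × (∀ i j → i F.< j → u i < u j)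

-- V_{a,b,n,u} is tileable exactly when its dents are spread out: u_i ≥ 2i for every i.
-- This condition survives raising the u_i, which gives the theorem.
--
-- Sufficiency, by induction on n and b: if the lowest dent is at the bottom of the
-- north-west side, it leaves a strip of parallel lozenges along the south-west side, and
-- removing this strip turns the region into one with a longer south-west side and one dent
-- fewer; otherwise the two bottom rows and the south-west diagonal are tiled by parallel
-- lozenges, and what remains is the region with a shorter south-west side.
--
-- Necessity, by counting triangles row by row: the down triangle of a lozenge lies in the
-- row of its up triangle or just below. Hence in a tiled region the top k rows contain at
-- least as many up as down triangles, and the whole region equally many. Without dents,
-- row y has [y even] − [y < b] more up than down triangles (rows counted from the
-- bottom, total height 2(b + n)). The global count shows that all n dents are inside the
-- region, and then the top u_i rows, which contain the first i dents but at most u_i / 2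
-- even rows, give 2i ≤ u_i.

module Submission where

open import Defs
open import Data.Bool using (Bool; true; false; T; if_then_else_)
open import Data.Bool.Properties using (T-≡; T-∧; ∨-identityʳ)
open import Data.Empty using (⊥; ⊥-elim)
open import Data.Fin using (Fin; toℕ; fromℕ; inject₁)
import Data.Fin as F
open import Data.Fin.Properties using (toℕ-inject₁; toℕ-fromℕ; inject₁ℕ<; any?)
open import Data.Fin.Relation.Unary.Top using (view; ‵fromℕ; ‵inject₁)
open import Data.List using (List; []; _∷_; _++_; map)
open import Data.List.Relation.Unary.All using (All; []; _∷_)
import Data.List.Relation.Unary.All as All
import Data.List.Relation.Unary.All.Properties as All
open import Data.Nat using (ℕ; zero; suc; pred; _+_; _*_; _∸_; _≤_; _<_; _≡ᵇ_; z≤n; s≤s; _≟_; _≤?_)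
open import Data.Nat.Properties
open import Data.Nat.Tactic.RingSolver using (solve-∀)
open import Data.Product using (Σ; Σ-syntax; _×_; _,_; proj₁; proj₂)
open import Data.Sum using (_⊎_; inj₁; inj₂; [_,_]′)
open import Function using (_∘_; Equivalence)
open import Relation.Binary.PropositionalEquality using (_≡_; refl; sym; trans; cong; cong₂; subst; subst₂; module ≡-Reasoning)
open import Relation.Nullary using (¬_; Dec; yes; no; does)
open import Relation.Nullary.Decidable using (_×-dec_; ¬?)

open Equivalence using (to; from)

-- Lozenge tilings of general regions

tri≡ᵇ⇒≡ : ∀ σ τ → T (tri≡ᵇ σ τ) → σ ≡ τ
tri≡ᵇ⇒≡ (tri up x y) (tri up x′ y′) p with to T-∧ p
... | q , r rewrite ≡ᵇ⇒≡ x x′ q | ≡ᵇ⇒≡ y y′ r = refl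
tri≡ᵇ⇒≡ (tri down x y) (tri down x′ y′) p with to T-∧ p
... | q , r rewrite ≡ᵇ⇒≡ x x′ q | ≡ᵇ⇒≡ y y′ r = refl

tri≡ᵇ-refl : ∀ σ → tri≡ᵇ σ σ ≡ true
tri≡ᵇ-refl (tri o x y) = to T-≡ (from T-∧ (ori-refl o , from T-∧ (≡⇒≡ᵇ x x refl , ≡⇒≡ᵇ y y refl)))
  where
  ori-refl : ∀ o → T (ori≡ᵇ o o)
  ori-refl up = _
  ori-refl down = _

upTri downTri : Loz → Tri
upTri l = proj₁ (trisOf l)
downTri l = proj₂ (trisOf l)

LozengeIn : Region → Loz → Set
LozengeIn R l = R (upTri l) × R (downTri l)

covers⇒ : ∀ l τ → covers l τ ≡ true → upTri l ≡ τ ⊎ downTri l ≡ τ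
covers⇒ l τ p with tri≡ᵇ (upTri l) τ in e
... | true = inj₁ (tri≡ᵇ⇒≡ _ _ (from T-≡ e))
... | false = inj₂ (tri≡ᵇ⇒≡ _ _ (from T-≡ p))

coverCount-outside : ∀ (R : Region) ls τ → All (LozengeIn R) ls → ¬ R τ → coverCount τ ls ≡ 0
coverCount-outside R [] τ [] τ∉R = refl
coverCount-outside R (l ∷ ls) τ ((r₁ , r₂) ∷ ls⊆R) τ∉R with covers l τ in e
... | true with covers⇒ l τ e
...   | inj₁ refl = ⊥-elim (τ∉R r₁)
...   | inj₂ refl = ⊥-elim (τ∉R r₂)
coverCount-outside R (l ∷ ls) τ (_ ∷ ls⊆R) τ∉R | false = coverCount-outside R ls τ ls⊆R τ∉R

coverCount-++ : ∀ τ ls ks → coverCount τ (ls ++ ks) ≡ coverCount τ ls + coverCount τ ks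
coverCount-++ τ [] ks = refl
coverCount-++ τ (l ∷ ls) ks =
  trans (cong (_ +_) (coverCount-++ τ ls ks)) (sym (+-assoc (if covers l τ then 1 else 0) _ _))

empty-tiling : (R : Region) → (∀ τ → ¬ R τ) → LozengeTiling R
empty-tiling R R-empty = [] , [] , λ τ r → ⊥-elim (R-empty τ r)

LozengeRegion : Loz → Region
LozengeRegion l τ = upTri l ≡ τ ⊎ downTri l ≡ τ

lozenge-tiling : ∀ l → LozengeTiling (LozengeRegion l)
lozenge-tiling l = (l ∷ []) , ((inj₁ refl , inj₂ refl) ∷ []) , covered-once
  where
  covered-once : ∀ τ → LozengeRegion l τ → coverCount τ (l ∷ []) ≡ 1
  covered-once τ (inj₁ refl) rewrite tri≡ᵇ-refl (upTri l) = refl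
  covered-once τ (inj₂ refl) rewrite tri≡ᵇ-refl (downTri l) with tri≡ᵇ (upTri l) (downTri l)
  ... | true = refl
  ... | false = refl

_∪_ : Region → Region → Region
(R ∪ S) τ = R τ ⊎ S τ

Disjoint : Region → Region → Set
Disjoint R S = ∀ τ → R τ → S τ → ⊥

∪-tiling : ∀ {R S} → LozengeTiling R → LozengeTiling S → Disjoint R S → LozengeTiling (R ∪ S)
∪-tiling {R} {S} (ls , ls⊆R , ls-cov) (ks , ks⊆S , ks-cov) R∩S=∅ =
  ls ++ ks ,
  All.++⁺ (All.map (λ (p , q) → inj₁ p , inj₁ q) ls⊆R) (All.map (λ (p , q) → inj₂ p , inj₂ q) ks⊆S) ,
  cov
  where
  cov : ∀ τ → (R ∪ S) τ → coverCount τ (ls ++ ks) ≡ 1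
  cov τ (inj₁ r) rewrite coverCount-++ τ ls ks | ls-cov τ r
    | coverCount-outside S ks τ ks⊆S (R∩S=∅ τ r) = refl
  cov τ (inj₂ s) rewrite coverCount-++ τ ls ks | ks-cov τ s
    | coverCount-outside R ls τ ls⊆R (λ r → R∩S=∅ τ r s) = refl

tiling-resp : ∀ {R S} → (∀ τ → R τ → S τ) → (∀ τ → S τ → R τ) → LozengeTiling R → LozengeTiling S
tiling-resp R⊆S S⊆R (ls , ls⊆R , cov) =
  ls , All.map (λ (p , q) → R⊆S _ p , R⊆S _ q) ls⊆R , λ τ s → cov τ (S⊆R τ s)

shiftTri : ℕ → ℕ → Tri → Tri
shiftTri dx dy (tri o x y) = tri o (dx + x) (dy + y)

shiftLoz : ℕ → ℕ → Loz → Loz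
shiftLoz dx dy (lozA x y) = lozA (dx + x) (dy + y)
shiftLoz dx dy (lozB x y) = lozB (dx + x) (dy + y)
shiftLoz dx dy (lozC x y) = lozC (dx + x) (dy + y)

Shift : ℕ → ℕ → Region → Region
Shift dx dy R τ = Σ[ σ ∈ Tri ] (R σ × shiftTri dx dy σ ≡ τ)

+-cancelˡ-≡ᵇ : ∀ d x x′ → ((d + x) ≡ᵇ (d + x′)) ≡ (x ≡ᵇ x′)
+-cancelˡ-≡ᵇ zero x x′ = refl
+-cancelˡ-≡ᵇ (suc d) x x′ = +-cancelˡ-≡ᵇ d x x′

tri≡ᵇ-shift : ∀ dx dy σ τ → tri≡ᵇ (shiftTri dx dy σ) (shiftTri dx dy τ) ≡ tri≡ᵇ σ τ
tri≡ᵇ-shift dx dy (tri o x y) (tri o′ x′ y′)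
  rewrite +-cancelˡ-≡ᵇ dx x x′ | +-cancelˡ-≡ᵇ dy y y′ = refl

upTri-shift : ∀ dx dy l → upTri (shiftLoz dx dy l) ≡ shiftTri dx dy (upTri l)
upTri-shift dx dy (lozA x y) = refl
upTri-shift dx dy (lozB x y) = cong (λ z → tri up z (dy + y)) (sym (+-suc dx x))
upTri-shift dx dy (lozC x y) = cong (tri up (dx + x)) (sym (+-suc dy y))

downTri-shift : ∀ dx dy l → downTri (shiftLoz dx dy l) ≡ shiftTri dx dy (downTri l)
downTri-shift dx dy (lozA x y) = refl
downTri-shift dx dy (lozB x y) = refl
downTri-shift dx dy (lozC x y) = refl

coverCount-shift : ∀ dx dy ls σ → coverCount (shiftTri dx dy σ) (map (shiftLoz dx dy) ls) ≡ coverCount σ ls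
coverCount-shift dx dy [] σ = refl
coverCount-shift dx dy (l ∷ ls) σ
  rewrite upTri-shift dx dy l | downTri-shift dx dy l
        | tri≡ᵇ-shift dx dy (upTri l) σ | tri≡ᵇ-shift dx dy (downTri l) σ
        | coverCount-shift dx dy ls σ = refl

Shift-tiling : ∀ dx dy {R} → LozengeTiling R → LozengeTiling (Shift dx dy R)
Shift-tiling dx dy {R} (ls , ls⊆R , cov) = map (shiftLoz dx dy) ls , shifted ls ls⊆R , cov′
  where
  shifted : ∀ ls → All (LozengeIn R) ls → All (LozengeIn (Shift dx dy R)) (map (shiftLoz dx dy) ls)
  shifted [] [] = []
  shifted (l ∷ ls) ((p , q) ∷ ls⊆R) =
    ((_ , p , sym (upTri-shift dx dy l)) , (_ , q , sym (downTri-shift dx dy l))) ∷ shifted ls ls⊆R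
  cov′ : ∀ τ → Shift dx dy R τ → coverCount τ (map (shiftLoz dx dy) ls) ≡ 1
  cov′ τ (σ , r , refl) rewrite coverCount-shift dx dy ls σ = cov σ r

-- Finite sums and indicator counts

Σ< : ℕ → (ℕ → ℕ) → ℕ
Σ< zero f = 0
Σ< (suc k) f = f 0 + Σ< k (f ∘ suc)

Σ<-cong : ∀ k {f g : ℕ → ℕ} → (∀ x → x < k → f x ≡ g x) → Σ< k f ≡ Σ< k g
Σ<-cong zero f≗g = refl
Σ<-cong (suc k) f≗g = cong₂ _+_ (f≗g 0 (s≤s z≤n)) (Σ<-cong k (λ x p → f≗g (suc x) (s≤s p)))

Σ<-mono : ∀ k {f g : ℕ → ℕ} → (∀ x → x < k → f x ≤ g x) → Σ< k f ≤ Σ< k g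
Σ<-mono zero f≤g = z≤n
Σ<-mono (suc k) f≤g = +-mono-≤ (f≤g 0 (s≤s z≤n)) (Σ<-mono k (λ x p → f≤g (suc x) (s≤s p)))

Σ<-+ : ∀ k (f g : ℕ → ℕ) → Σ< k (λ x → f x + g x) ≡ Σ< k f + Σ< k g
Σ<-+ zero f g = refl
Σ<-+ (suc k) f g rewrite Σ<-+ k (f ∘ suc) (g ∘ suc) = interchange (f 0) (g 0) _ _
  where
  interchange : ∀ a b c d → a + b + (c + d) ≡ a + c + (b + d)
  interchange = solve-∀

Σ<≡0 : ∀ k (f : ℕ → ℕ) → (∀ x → x < k → f x ≡ 0) → Σ< k f ≡ 0
Σ<≡0 zero f f≡0 = refl
Σ<≡0 (suc k) f f≡0 rewrite f≡0 0 (s≤s z≤n) = Σ<≡0 k (f ∘ suc) (λ x p → f≡0 (suc x) (s≤s p))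

Σ<-suc : ∀ k (f : ℕ → ℕ) → Σ< (suc k) f ≡ Σ< k f + f k
Σ<-suc zero f = +-comm (f 0) 0
Σ<-suc (suc k) f rewrite Σ<-suc k (f ∘ suc) = sym (+-assoc (f 0) _ _)

Σ<-split : ∀ m k (f : ℕ → ℕ) → Σ< (m + k) f ≡ Σ< m f + Σ< k (λ x → f (m + x))
Σ<-split zero k f = refl
Σ<-split (suc m) k f = trans (cong (f 0 +_) (Σ<-split m k (f ∘ suc))) (sym (+-assoc (f 0) _ _))

Σ<-mono-range : ∀ {m k} (f : ℕ → ℕ) → m ≤ k → Σ< m f ≤ Σ< k f
Σ<-mono-range {zero} f p = z≤n
Σ<-mono-range {suc m} {suc k} f (s≤s p) = +-monoʳ-≤ (f 0) (Σ<-mono-range (f ∘ suc) p)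

term≤Σ< : ∀ k (f : ℕ → ℕ) x → x < k → f x ≤ Σ< k f
term≤Σ< (suc k) f zero p = m≤m+n (f 0) _
term≤Σ< (suc k) f (suc x) (s≤s p) = ≤-trans (term≤Σ< k (f ∘ suc) x p) (m≤n+m _ (f 0))

Σ<-≤-length : ∀ k (f : ℕ → ℕ) → (∀ x → x < k → f x ≤ 1) → Σ< k f ≤ k
Σ<-≤-length zero f f≤1 = z≤n
Σ<-≤-length (suc k) f f≤1 = +-mono-≤ (f≤1 0 (s≤s z≤n)) (Σ<-≤-length k (f ∘ suc) (λ x p → f≤1 (suc x) (s≤s p)))

Σ<-positive : ∀ k (f : ℕ → ℕ) → 1 ≤ Σ< k f → Σ[ x ∈ ℕ ] (x < k × 1 ≤ f x)
Σ<-positive (suc k) f p with f 0 in e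
... | suc _ = 0 , s≤s z≤n , subst (1 ≤_) (sym e) (s≤s z≤n)
... | zero with Σ<-positive k (f ∘ suc) p
...   | x , x<k , fx≥1 = suc x , s≤s x<k , fx≥1

Σ<≤1 : ∀ k (f : ℕ → ℕ) → (∀ x → x < k → f x ≤ 1) →
  (∀ x x′ → x < k → x′ < k → 1 ≤ f x → 1 ≤ f x′ → x ≡ x′) → Σ< k f ≤ 1
Σ<≤1 zero f f≤1 unique = z≤n
Σ<≤1 (suc k) f f≤1 unique with f 0 in e
... | zero = Σ<≤1 k (f ∘ suc) (λ x p → f≤1 (suc x) (s≤s p))
               (λ x x′ p p′ q q′ → suc-injective (unique (suc x) (suc x′) (s≤s p) (s≤s p′) q q′))
... | suc v = subst (_≤ 1) (sym (cong₂ _+_ f0≡1 rest≡0)) ≤-refl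
  where
  f0≡1 : suc v ≡ 1
  f0≡1 = ≤-antisym (subst (_≤ 1) e (f≤1 0 (s≤s z≤n))) (s≤s z≤n)
  rest-vanishes : ∀ x → x < k → f (suc x) ≡ 0
  rest-vanishes x p with f (suc x) in e′
  ... | zero = refl
  ... | suc w with unique 0 (suc x) (s≤s z≤n) (s≤s p)
                    (subst (1 ≤_) (sym e) (s≤s z≤n)) (subst (1 ≤_) (sym e′) (s≤s z≤n))
  ...   | ()
  rest≡0 : Σ< k (f ∘ suc) ≡ 0
  rest≡0 = Σ<≡0 k (f ∘ suc) rest-vanishes

listSum : ∀ {A : Set} → List A → (A → ℕ) → ℕ
listSum [] f = 0
listSum (x ∷ xs) f = f x + listSum xs f

listSum-cong : ∀ {A : Set} (xs : List A) {f g : A → ℕ} → (∀ x → f x ≡ g x) → listSum xs f ≡ listSum xs g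
listSum-cong [] f≗g = refl
listSum-cong (x ∷ xs) f≗g = cong₂ _+_ (f≗g x) (listSum-cong xs f≗g)

listSum-mono : ∀ {A : Set} {P : A → Set} (xs : List A) {f g : A → ℕ} →
  All P xs → (∀ x → P x → f x ≤ g x) → listSum xs f ≤ listSum xs g
listSum-mono [] [] f≤g = z≤n
listSum-mono (x ∷ xs) (p ∷ ps) f≤g = +-mono-≤ (f≤g x p) (listSum-mono xs ps f≤g)

Σ<-listSum-comm : ∀ {A : Set} k (xs : List A) (F : ℕ → A → ℕ) →
  Σ< k (λ r → listSum xs (F r)) ≡ listSum xs (λ a → Σ< k (λ r → F r a))
Σ<-listSum-comm k [] F = Σ<≡0 k _ (λ _ _ → refl)
Σ<-listSum-comm k (x ∷ xs) F =
  trans (Σ<-+ k (λ r → F r x) (λ r → listSum xs (F r))) (cong (Σ< k (λ r → F r x) +_) (Σ<-listSum-comm k xs F))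

ind : Bool → ℕ
ind b = if b then 1 else 0

ind≤1 : ∀ b → ind b ≤ 1
ind≤1 true = s≤s z≤n
ind≤1 false = z≤n

1≤ind⇒T : ∀ {b} → 1 ≤ ind b → T b
1≤ind⇒T {true} _ = _

χ : ∀ {P : Set} → Dec P → ℕ
χ d = ind (does d)

χ≤1 : ∀ {P : Set} (d : Dec P) → χ d ≤ 1
χ≤1 d = ind≤1 (does d)

χ-yes : ∀ {P : Set} (d : Dec P) → P → χ d ≡ 1
χ-yes (yes _) p = refl
χ-yes (no ¬p) p = ⊥-elim (¬p p)

χ-no : ∀ {P : Set} (d : Dec P) → ¬ P → χ d ≡ 0
χ-no (yes p) ¬p = ⊥-elim (¬p p)
χ-no (no _) ¬p = refl

1≤χ⇒ : ∀ {P : Set} (d : Dec P) → 1 ≤ χ d → P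
1≤χ⇒ (yes p) _ = p

χ-cong : ∀ {P Q : Set} → (P → Q) → (Q → P) → (d : Dec P) (e : Dec Q) → χ d ≡ χ e
χ-cong f g (yes p) (yes q) = refl
χ-cong f g (yes p) (no ¬q) = ⊥-elim (¬q (f p))
χ-cong f g (no ¬p) (yes q) = ⊥-elim (¬p (g q))
χ-cong f g (no ¬p) (no ¬q) = refl

χ-⊎-≤ : ∀ {P Q R : Set} → (P → Q ⊎ R) → (dP : Dec P) (dQ : Dec Q) (dR : Dec R) → χ dP ≤ χ dQ + χ dR
χ-⊎-≤ f (no _) dQ dR = z≤n
χ-⊎-≤ f (yes p) (yes _) dR = s≤s z≤n
χ-⊎-≤ f (yes p) (no ¬q) (yes _) = s≤s z≤n
χ-⊎-≤ f (yes p) (no ¬q) (no ¬r) with f p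
... | inj₁ q = ⊥-elim (¬q q)
... | inj₂ r = ⊥-elim (¬r r)

χ-disjoint-≤ : ∀ {P Q R : Set} → (P → R) → (Q → R) → (P → Q → ⊥) →
  (dP : Dec P) (dQ : Dec Q) (dR : Dec R) → χ dP + χ dQ ≤ χ dR
χ-disjoint-≤ f g P∩Q=∅ (yes p) (yes q) dR = ⊥-elim (P∩Q=∅ p q)
χ-disjoint-≤ f g P∩Q=∅ (yes p) (no _) dR = ≤-reflexive (sym (χ-yes dR (f p)))
χ-disjoint-≤ f g P∩Q=∅ (no _) (yes q) dR = ≤-reflexive (sym (χ-yes dR (g q)))
χ-disjoint-≤ f g P∩Q=∅ (no _) (no _) dR = z≤n

χ-complement : ∀ {P Q : Set} (dP : Dec P) (dQ : Dec Q) → (P → Q → ⊥) → (¬ P → Q) → χ dP + χ dQ ≡ 1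
χ-complement (yes p) (yes q) P∩Q=∅ _ = ⊥-elim (P∩Q=∅ p q)
χ-complement (yes _) (no _) _ _ = refl
χ-complement (no _) (yes _) _ _ = refl
χ-complement (no ¬p) (no ¬q) _ ¬P⇒Q = ⊥-elim (¬q (¬P⇒Q ¬p))

χ-disjoint-⊎ : ∀ {P Q R : Set} → (P → Q ⊎ R) → (Q → P) → (R → P) → (Q → R → ⊥) →
  (dP : Dec P) (dQ : Dec Q) (dR : Dec R) → χ dP ≡ χ dQ + χ dR
χ-disjoint-⊎ f g h Q∩R=∅ dP dQ dR =
  ≤-antisym (χ-⊎-≤ f dP dQ dR) (χ-disjoint-≤ g h Q∩R=∅ dQ dR dP)

-- Dented half-hexagons in normal form

+≡⇒≤ : ∀ {m n} k → m + k ≡ n → m ≤ n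
+≡⇒≤ {m} k refl = m≤m+n m k

-- Rows 0 ≤ y < H between the south-west side X + y = b and the line L : 2X + y = 2c, with
-- the first up triangle of row y on the north-west side X = 0 removed when D y holds.
-- V a b n u has the triangles of HalfHexV a b n u; dent u_i removes the first up triangle
-- of row H − u_i.
HalfHex : (b c H : ℕ) → (ℕ → Set) → Region
HalfHex b c H D (tri up X y) = (suc y ≤ H) × (b ≤ X + y) × (2 * X + y + 2 ≤ 2 * c) × ¬ (X ≡ 0 × D y)
HalfHex b c H D (tri down X y) = (suc y ≤ H) × (b ≤ suc (X + y)) × (2 * X + y + 3 ≤ 2 * c)

DentRow : (n : ℕ) → (Fin n → ℕ) → ℕ → ℕ → Set
DentRow n u H y = Σ[ i ∈ Fin n ] (y + u i ≡ H)

HalfHexV : (a b n : ℕ) → (Fin n → ℕ) → Region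
HalfHexV a b n u = HalfHex b (a + n + b) (b + b + 2 * n) (DentRow n u (b + b + 2 * n))

-- West of L the north-east and south-east sides of the hexagon are never reached, and the
-- north-east dents lie east of L.
module _ (a b n : ℕ) where

  westOfL⇒east-bound : ∀ X y → 2 * X + y + 2 ≤ 2 * (a + n + b) → X + 1 ≤ 2 * a + b + 2 * n
  westOfL⇒east-bound X y west =
    ≤-trans {j = a + n + b} (*-cancelˡ-≤ 2 (≤-trans (+≡⇒≤ y (eq X y)) west)) (+≡⇒≤ (a + n) (eq′ a n b))
    where
    eq : ∀ X y → 2 * (X + 1) + y ≡ 2 * X + y + 2
    eq = solve-∀
    eq′ : ∀ a n b → a + n + b + (a + n) ≡ 2 * a + b + 2 * n
    eq′ = solve-∀

  private
    west+height : ∀ X y k → 2 * X + y + k ≤ 2 * (a + n + b) → y + 1 ≤ b + b + 2 * n →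
      2 * X + y + k + (y + 1) ≤ 2 * (2 * a + b + b + 2 * n)
    west+height X y k west y<H = ≤-trans (+-mono-≤ west y<H) (+≡⇒≤ (2 * a) (eq a n b))
      where
      eq : ∀ a n b → 2 * (a + n + b) + (b + b + 2 * n) + 2 * a ≡ 2 * (2 * a + b + b + 2 * n)
      eq = solve-∀

  westOfL⇒NE-bound-up : ∀ X y → 2 * X + y + 2 ≤ 2 * (a + n + b) → y + 1 ≤ b + b + 2 * n →
    X + y + 1 ≤ 2 * a + b + b + 2 * n
  westOfL⇒NE-bound-up X y west y<H =
    *-cancelˡ-≤ 2 (≤-trans (+≡⇒≤ 1 (eq X y)) (west+height X y 2 west y<H))
    where
    eq : ∀ X y → 2 * (X + y + 1) + 1 ≡ 2 * X + y + 2 + (y + 1)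
    eq = solve-∀

  westOfL⇒NE-bound-down : ∀ X y → 2 * X + y + 3 ≤ 2 * (a + n + b) → y + 1 ≤ b + b + 2 * n →
    X + y + 2 ≤ 2 * a + b + b + 2 * n
  westOfL⇒NE-bound-down X y west y<H =
    *-cancelˡ-≤ 2 (≤-trans (≤-reflexive (eq X y)) (west+height X y 3 west y<H))
    where
    eq : ∀ X y → 2 * (X + y + 2) ≡ 2 * X + y + 3 + (y + 1)
    eq = solve-∀

  NEdent-eastOfL : ∀ X y w → 1 ≤ w → X + 1 ≡ 2 * a + w → y + w ≡ b + b + 2 * n →
    ¬ (2 * X + y + 2 ≤ 2 * (a + n + b))
  NEdent-eastOfL X y w w≥1 X≡ y≡ west =
    <⇒≱ too-far-east (subst (_≤ 2 * (a + n + b) + w) (eq X y w) (+-monoˡ-≤ w west))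
    where
    eq : ∀ X y w → 2 * X + y + 2 + w ≡ 2 * (X + 1) + (y + w)
    eq = solve-∀
    too-far-east : 2 * (a + n + b) + w < 2 * (X + 1) + (y + w)
    too-far-east rewrite X≡ | y≡ = subst (2 * (a + n + b) + w <_) (eq′ a n b w)
      (m<m+n (2 * (a + n + b) + w) (≤-trans w≥1 (m≤n+m w (2 * a))))
      where
      eq′ : ∀ a n b w → 2 * (a + n + b) + w + (2 * a + w) ≡ 2 * (2 * a + w) + (b + b + 2 * n)
      eq′ = solve-∀

V⇒HalfHexV : ∀ a b n (u : Fin n → ℕ) τ → V a b n u τ → HalfHexV a b n u τ
V⇒HalfHexV a b n u (tri up X y) (((y<H , _ , SW , _) , _ , ¬NW) , west) =
  subst (_≤ b + b + 2 * n) (+-comm y 1) y<H , SW , west , λ (X≡0 , i , e) → ¬NW (i , refl , X≡0 , e)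
V⇒HalfHexV a b n u (tri down X y) (((y<H , _ , SW , _) , _ , _) , west) =
  subst (_≤ b + b + 2 * n) (+-comm y 1) y<H , subst (b ≤_) (+-comm (X + y) 1) SW , west

HalfHexV⇒V : ∀ a b n (u : Fin n → ℕ) → (∀ i → 1 ≤ u i) → ∀ τ → HalfHexV a b n u τ → V a b n u τ
HalfHexV⇒V a b n u u≥1 (tri up X y) (y<H , SW , west , ¬dent) =
  ((y<H′ , westOfL⇒east-bound a b n X y west , SW , westOfL⇒NE-bound-up a b n X y west y<H′) ,
   (λ (i , _ , X≡ , y≡) → NEdent-eastOfL a b n X y (u i) (u≥1 i) X≡ y≡ west) ,
   (λ (j , _ , X≡0 , e) → ¬dent (X≡0 , j , e))) , west
  where
  y<H′ : y + 1 ≤ b + b + 2 * n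
  y<H′ = subst (_≤ b + b + 2 * n) (+-comm 1 y) y<H
HalfHexV⇒V a b n u u≥1 (tri down X y) (y<H , SW , west) =
  ((y<H′ , westOfL⇒east-bound a b n X y (≤-trans (+-monoʳ-≤ (2 * X + y) (n≤1+n 2)) west) ,
    subst (b ≤_) (+-comm 1 (X + y)) SW , westOfL⇒NE-bound-down a b n X y west y<H′) ,
   (λ { (_ , () , _) }) , (λ { (_ , () , _) })) , west
  where
  y<H′ : y + 1 ≤ b + b + 2 * n
  y<H′ = subst (_≤ b + b + 2 * n) (+-comm 1 y) y<H

-- Constructing tilings from strips of parallel lozenges

∅ : Region
∅ _ = ⊥

∅-tiling : LozengeTiling ∅
∅-tiling = empty-tiling ∅ (λ _ ())

BStrip : ℕ → Region
BStrip zero = ∅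
BStrip (suc k) = LozengeRegion (lozB k 0) ∪ Shift 0 1 (BStrip k)

BStrip-up⇒ : ∀ k X y → BStrip k (tri up X y) → Σ[ X′ ∈ ℕ ] (X ≡ suc X′ × suc (X′ + y) ≡ k)
BStrip-up⇒ (suc k) .(suc k) .0 (inj₁ (inj₁ refl)) = k , refl , cong suc (+-identityʳ k)
BStrip-up⇒ (suc k) X .(suc y) (inj₂ (tri up .X y , s , refl)) with BStrip-up⇒ k X y s
... | X′ , X≡ , e = X′ , X≡ , cong suc (trans (+-suc X′ y) e)

BStrip-down⇒ : ∀ k X y → BStrip k (tri down X y) → suc (X + y) ≡ k
BStrip-down⇒ (suc k) .k .0 (inj₁ (inj₂ refl)) = cong suc (+-identityʳ k)
BStrip-down⇒ (suc k) X .(suc y) (inj₂ (tri down .X y , s , refl)) =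
  cong suc (trans (+-suc X y) (BStrip-down⇒ k X y s))

⇒BStrip-up : ∀ k X′ y → suc (X′ + y) ≡ k → BStrip k (tri up (suc X′) y)
⇒BStrip-up (suc k) X′ zero e rewrite +-identityʳ X′ | suc-injective e = inj₁ (inj₁ refl)
⇒BStrip-up (suc k) X′ (suc y) e =
  inj₂ (tri up (suc X′) y , ⇒BStrip-up k X′ y (suc-injective (trans (cong suc (sym (+-suc X′ y))) e)) , refl)

⇒BStrip-down : ∀ k X y → suc (X + y) ≡ k → BStrip k (tri down X y)
⇒BStrip-down (suc k) X zero e rewrite +-identityʳ X | suc-injective e = inj₁ (inj₂ refl)
⇒BStrip-down (suc k) X (suc y) e =
  inj₂ (tri down X y , ⇒BStrip-down k X y (suc-injective (trans (cong suc (sym (+-suc X y))) e)) , refl)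

BStrip-tiling : ∀ k → LozengeTiling (BStrip k)
BStrip-tiling zero = ∅-tiling
BStrip-tiling (suc k) = ∪-tiling (lozenge-tiling (lozB k 0)) (Shift-tiling 0 1 (BStrip-tiling k)) disjoint
  where
  disjoint : Disjoint (LozengeRegion (lozB k 0)) (Shift 0 1 (BStrip k))
  disjoint τ (inj₁ refl) (tri o x y , _ , ())
  disjoint τ (inj₂ refl) (tri o x y , _ , ())

BRow : ℕ → Region
BRow zero = ∅
BRow (suc m) = LozengeRegion (lozB 0 0) ∪ Shift 1 0 (BRow m)

BRow-up⇒ : ∀ m X y → BRow m (tri up X y) → y ≡ 0 × Σ[ j ∈ ℕ ] (X ≡ suc j × suc j ≤ m)
BRow-up⇒ (suc m) .1 .0 (inj₁ (inj₁ refl)) = refl , 0 , refl , s≤s z≤n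
BRow-up⇒ (suc m) .(suc X) y (inj₂ (tri up X .y , s , refl)) with BRow-up⇒ m X y s
... | y≡0 , j , refl , j<m = y≡0 , suc j , refl , s≤s j<m

BRow-down⇒ : ∀ m X y → BRow m (tri down X y) → y ≡ 0 × X < m
BRow-down⇒ (suc m) .0 .0 (inj₁ (inj₂ refl)) = refl , s≤s z≤n
BRow-down⇒ (suc m) .(suc X) y (inj₂ (tri down X .y , s , refl)) with BRow-down⇒ m X y s
... | y≡0 , X<m = y≡0 , s≤s X<m

⇒BRow-up : ∀ m j → suc j ≤ m → BRow m (tri up (suc j) 0)
⇒BRow-up (suc m) zero _ = inj₁ (inj₁ refl)
⇒BRow-up (suc m) (suc j) (s≤s j<m) = inj₂ (tri up (suc j) 0 , ⇒BRow-up m j j<m , refl)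

⇒BRow-down : ∀ m X → X < m → BRow m (tri down X 0)
⇒BRow-down (suc m) zero _ = inj₁ (inj₂ refl)
⇒BRow-down (suc m) (suc X) (s≤s X<m) = inj₂ (tri down X 0 , ⇒BRow-down m X X<m , refl)

BRow-tiling : ∀ m → LozengeTiling (BRow m)
BRow-tiling zero = ∅-tiling
BRow-tiling (suc m) = ∪-tiling (lozenge-tiling (lozB 0 0)) (Shift-tiling 1 0 (BRow-tiling m)) disjoint
  where
  disjoint : Disjoint (LozengeRegion (lozB 0 0)) (Shift 1 0 (BRow m))
  disjoint τ (inj₁ refl) (tri up zero y , s , refl) with BRow-up⇒ m 0 y s
  ... | _ , _ , () , _
  disjoint τ (inj₁ refl) (tri down x y , _ , ())
  disjoint τ (inj₂ refl) (tri up x y , _ , ())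
  disjoint τ (inj₂ refl) (tri down x y , _ , ())

ARow : ℕ → Region
ARow zero = ∅
ARow (suc m) = LozengeRegion (lozA 0 1) ∪ Shift 1 0 (ARow m)

ARow-up⇒ : ∀ m X y → ARow m (tri up X y) → y ≡ 1 × X < m
ARow-up⇒ (suc m) .0 .1 (inj₁ (inj₁ refl)) = refl , s≤s z≤n
ARow-up⇒ (suc m) .(suc X) y (inj₂ (tri up X .y , s , refl)) with ARow-up⇒ m X y s
... | y≡1 , X<m = y≡1 , s≤s X<m

ARow-down⇒ : ∀ m X y → ARow m (tri down X y) → y ≡ 1 × X < m
ARow-down⇒ (suc m) .0 .1 (inj₁ (inj₂ refl)) = refl , s≤s z≤n
ARow-down⇒ (suc m) .(suc X) y (inj₂ (tri down X .y , s , refl)) with ARow-down⇒ m X y s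
... | y≡1 , X<m = y≡1 , s≤s X<m

⇒ARow-up : ∀ m X → X < m → ARow m (tri up X 1)
⇒ARow-up (suc m) zero _ = inj₁ (inj₁ refl)
⇒ARow-up (suc m) (suc X) (s≤s X<m) = inj₂ (tri up X 1 , ⇒ARow-up m X X<m , refl)

⇒ARow-down : ∀ m X → X < m → ARow m (tri down X 1)
⇒ARow-down (suc m) zero _ = inj₁ (inj₂ refl)
⇒ARow-down (suc m) (suc X) (s≤s X<m) = inj₂ (tri down X 1 , ⇒ARow-down m X X<m , refl)

ARow-tiling : ∀ m → LozengeTiling (ARow m)
ARow-tiling zero = ∅-tiling
ARow-tiling (suc m) = ∪-tiling (lozenge-tiling (lozA 0 1)) (Shift-tiling 1 0 (ARow-tiling m)) disjoint
  where
  disjoint : Disjoint (LozengeRegion (lozA 0 1)) (Shift 1 0 (ARow m))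
  disjoint τ (inj₁ refl) (tri o x y , _ , ())
  disjoint τ (inj₂ refl) (tri o x y , _ , ())

CStrip : ℕ → Region
CStrip zero = ∅
CStrip (suc zero) = LozengeRegion (lozC 0 1)
CStrip (suc (suc k)) = LozengeRegion (lozC (suc k) 1) ∪ Shift 0 1 (CStrip (suc k))

CStrip-up⇒ : ∀ k X y → CStrip (suc k) (tri up X y) → Σ[ t ∈ ℕ ] (y ≡ 2 + t × X + t ≡ k)
CStrip-up⇒ zero .0 .2 (inj₁ refl) = 0 , refl , refl
CStrip-up⇒ (suc k) .(suc k) .2 (inj₁ (inj₁ refl)) = 0 , refl , cong suc (+-identityʳ k)
CStrip-up⇒ (suc k) X .(suc y) (inj₂ (tri up .X y , s , refl)) with CStrip-up⇒ k X y s
... | t , refl , e = suc t , refl , trans (+-suc X t) (cong suc e)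

CStrip-down⇒ : ∀ k X y → CStrip (suc k) (tri down X y) → Σ[ t ∈ ℕ ] (y ≡ 1 + t × X + t ≡ k)
CStrip-down⇒ zero .0 .1 (inj₂ refl) = 0 , refl , refl
CStrip-down⇒ (suc k) .(suc k) .1 (inj₁ (inj₂ refl)) = 0 , refl , cong suc (+-identityʳ k)
CStrip-down⇒ (suc k) X .(suc y) (inj₂ (tri down .X y , s , refl)) with CStrip-down⇒ k X y s
... | t , refl , e = suc t , refl , trans (+-suc X t) (cong suc e)

⇒CStrip-up : ∀ k X t → X + t ≡ k → CStrip (suc k) (tri up X (2 + t))
⇒CStrip-up zero zero zero e = inj₁ refl
⇒CStrip-up (suc k) X zero e rewrite +-identityʳ X | e = inj₁ (inj₁ refl)
⇒CStrip-up (suc k) X (suc t) e =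
  inj₂ (tri up X (2 + t) , ⇒CStrip-up k X t (suc-injective (trans (sym (+-suc X t)) e)) , refl)

⇒CStrip-down : ∀ k X t → X + t ≡ k → CStrip (suc k) (tri down X (1 + t))
⇒CStrip-down zero zero zero e = inj₂ refl
⇒CStrip-down (suc k) X zero e rewrite +-identityʳ X | e = inj₁ (inj₂ refl)
⇒CStrip-down (suc k) X (suc t) e =
  inj₂ (tri down X (1 + t) , ⇒CStrip-down k X t (suc-injective (trans (sym (+-suc X t)) e)) , refl)

CStrip-tiling : ∀ k → LozengeTiling (CStrip k)
CStrip-tiling zero = ∅-tiling
CStrip-tiling (suc zero) = lozenge-tiling (lozC 0 1)
CStrip-tiling (suc (suc k)) = ∪-tiling (lozenge-tiling (lozC (suc k) 1)) (Shift-tiling 0 1 (CStrip-tiling (suc k))) disjoint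
  where
  disjoint : Disjoint (LozengeRegion (lozC (suc k) 1)) (Shift 0 1 (CStrip (suc k)))
  disjoint τ (inj₁ refl) (tri up x y , s , refl) with CStrip-up⇒ k x y s
  ... | t , () , _
  disjoint τ (inj₁ refl) (tri down x y , _ , ())
  disjoint τ (inj₂ refl) (tri up x y , _ , ())
  disjoint τ (inj₂ refl) (tri down x y , s , refl) with CStrip-down⇒ k x y s
  ... | t , () , _

-- A dent in the corner row b removes the only up triangle of the diagonal X + y = b
-- that has no B-lozenge partner, so this diagonal is a B-strip.
HalfHex-add-BStrip : ∀ b c H (D D′ : ℕ → Set) → suc b ≤ c → b ≤ H → D b →
  (∀ y → D′ y → D y) → (∀ y → D y → D′ y ⊎ y ≡ b) →
  LozengeTiling (HalfHex (suc b) c H D′) → LozengeTiling (HalfHex b c H D)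
HalfHex-add-BStrip b c H D D′ b<c b≤H D[b] D′⊆D D⊆D′+b tiling =
  tiling-resp ⊆HalfHex HalfHex⊆ (∪-tiling tiling (BStrip-tiling b) disjoint)
  where
  disjoint : Disjoint (HalfHex (suc b) c H D′) (BStrip b)
  disjoint (tri up X y) (_ , SW , _) s with BStrip-up⇒ b X y s
  ... | X′ , refl , refl = <⇒≢ SW refl
  disjoint (tri down X y) (_ , SW , _) s = <⇒≢ SW (sym (BStrip-down⇒ b X y s))

  ⊆HalfHex : ∀ τ → (HalfHex (suc b) c H D′ ∪ BStrip b) τ → HalfHex b c H D τ
  ⊆HalfHex (tri up X y) (inj₁ (y<H , SW , west , ¬dent)) = y<H , ≤-trans (n≤1+n b) SW , west , ¬dent′
    where
    ¬dent′ : ¬ (X ≡ 0 × D y)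
    ¬dent′ (X≡0 , d) with D⊆D′+b y d
    ... | inj₁ d′ = ¬dent (X≡0 , d′)
    ... | inj₂ refl rewrite X≡0 = n≮n y SW
  ⊆HalfHex (tri down X y) (inj₁ (y<H , SW , west)) = y<H , ≤-trans (n≤1+n b) SW , west
  ⊆HalfHex (tri up X y) (inj₂ s) with BStrip-up⇒ b X y s
  ... | X′ , refl , refl = ≤-trans (s≤s (+≡⇒≤ X′ (+-comm y X′))) b≤H , ≤-refl ,
        ≤-trans (+≡⇒≤ y (eq X′ y)) (*-monoʳ-≤ 2 b<c) , λ { (() , _) }
    where
    eq : ∀ x y → 2 * (1 + x) + y + 2 + y ≡ 2 * (2 + (x + y))
    eq = solve-∀
  ⊆HalfHex (tri down X y) (inj₂ s) with BStrip-down⇒ b X y s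
  ... | refl = ≤-trans (s≤s (+≡⇒≤ X (+-comm y X))) b≤H , ≤-refl ,
        ≤-trans (+≡⇒≤ (suc y) (eq X y)) (*-monoʳ-≤ 2 b<c)
    where
    eq : ∀ x y → 2 * x + y + 3 + (1 + y) ≡ 2 * (2 + (x + y))
    eq = solve-∀

  HalfHex⊆ : ∀ τ → HalfHex b c H D τ → (HalfHex (suc b) c H D′ ∪ BStrip b) τ
  HalfHex⊆ (tri up X y) (y<H , SW , west , ¬dent) with m≤n⇒m<n∨m≡n SW
  ... | inj₁ SW′ = inj₁ (y<H , SW′ , west , λ (X≡0 , d′) → ¬dent (X≡0 , D′⊆D y d′))
  HalfHex⊆ (tri up zero y) (y<H , SW , west , ¬dent) | inj₂ refl = ⊥-elim (¬dent (refl , D[b]))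
  HalfHex⊆ (tri up (suc X′) y) _ | inj₂ e = inj₂ (⇒BStrip-up b X′ y (sym e))
  HalfHex⊆ (tri down X y) (y<H , SW , west) with m≤n⇒m<n∨m≡n SW
  ... | inj₁ SW′ = inj₁ (y<H , SW′ , west)
  ... | inj₂ e = inj₂ (⇒BStrip-down b X y (sym e))

2+[X+y]≡X+[2+y] : ∀ X y → 2 + (X + y) ≡ X + (2 + y)
2+[X+y]≡X+[2+y] = solve-∀

CStrip⊆HalfHex : ∀ b m H (D : ℕ → Set) → b ≤ H → ¬ D (suc b) →
  ∀ τ → CStrip b τ → HalfHex (suc b) (suc b + m) (2 + H) D τ
CStrip⊆HalfHex (suc k) m H D 1+k≤H ¬D[2+k] (tri up X y) s with CStrip-up⇒ k X y s
... | t , refl , X+t≡k =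
  s≤s (s≤s (≤-trans (s≤s (+≡⇒≤ X (trans (+-comm t X) X+t≡k))) 1+k≤H)) ,
  ≤-reflexive (trans (cong (2 +_) (sym X+t≡k)) (2+[X+y]≡X+[2+y] X t)) ,
  ≤-trans (+≡⇒≤ t (eq X t)) (*-monoʳ-≤ 2 (subst (λ z → 2 + z ≤ 2 + k + m) (sym X+t≡k) (m≤m+n (2 + k) m))) ,
  λ (X≡0 , d) → ¬D[2+k] (subst (λ z → D (2 + z)) (trans (cong (_+ t) (sym X≡0)) X+t≡k) d)
  where
  eq : ∀ X t → 2 * X + (2 + t) + 2 + t ≡ 2 * (2 + (X + t))
  eq = solve-∀
CStrip⊆HalfHex (suc k) m H D 1+k≤H _ (tri down X y) s with CStrip-down⇒ k X y s
... | t , refl , X+t≡k =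
  s≤s (s≤s (≤-trans (+≡⇒≤ X (trans (+-comm t X) X+t≡k)) (≤-trans (n≤1+n k) 1+k≤H))) ,
  s≤s (≤-reflexive (trans (cong suc (sym X+t≡k)) (sym (+-suc X t)))) ,
  ≤-trans (+≡⇒≤ t (eq X t)) (*-monoʳ-≤ 2 (subst (λ z → 2 + z ≤ 2 + k + m) (sym X+t≡k) (m≤m+n (2 + k) m)))
  where
  eq : ∀ X t → 2 * X + (1 + t) + 3 + t ≡ 2 * (2 + (X + t))
  eq = solve-∀

pieces#CStrip : ∀ b m H (D : ℕ → Set) →
  Disjoint ((Shift 0 2 (HalfHex b (b + m) H (D ∘ (2 +_))) ∪ Shift b 0 (BRow m)) ∪ Shift b 0 (ARow m)) (CStrip b)
pieces#CStrip (suc k) m H D (tri up X y) p s with CStrip-up⇒ k X y s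
pieces#CStrip (suc k) m H D _ (inj₁ (inj₁ (tri up X t , (_ , SW , _) , refl))) s | t , refl , X+t≡k =
  1+n≰n (subst (suc k ≤_) X+t≡k SW)
pieces#CStrip (suc k) m H D _ (inj₁ (inj₂ (tri up X₀ y₀ , r , refl))) s | _ , refl , _ with BRow-up⇒ m X₀ y₀ r
... | () , _
pieces#CStrip (suc k) m H D _ (inj₂ (tri up X₀ y₀ , r , refl)) s | _ , refl , _ with ARow-up⇒ m X₀ y₀ r
... | () , _
pieces#CStrip (suc k) m H D (tri down X y) p s with CStrip-down⇒ k X y s
pieces#CStrip (suc k) m H D _ (inj₁ (inj₁ (tri down X y′ , (_ , SW , _) , refl))) s | t , refl , X+t≡k =
  1+n≰n (subst (_≤ suc (X + y′)) (cong suc (trans (sym X+t≡k) (+-suc X y′))) SW)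
pieces#CStrip (suc k) m H D _ (inj₁ (inj₂ (tri down X₀ y₀ , r , refl))) s | _ , refl , _ with BRow-down⇒ m X₀ y₀ r
... | () , _
pieces#CStrip (suc k) m H D _ (inj₂ (tri down X₀ y₀ , r , refl)) s | t , refl , X+t≡k with ARow-down⇒ m X₀ y₀ r
pieces#CStrip (suc k) m H D _ (inj₂ (tri down X₀ y₀ , r , refl)) s | zero , refl , X+t≡k | refl , _ =
  1+n≰n (≤-trans (+≡⇒≤ X₀ refl) (≤-reflexive (trans (sym (+-identityʳ _)) X+t≡k)))

-- The old region raised by two rows, a row of B-lozenges and a row of A-lozenges below it,
-- and a C-strip along the new south-west diagonal make up the enlarged region.
module BottomRows (b m H : ℕ) (D : ℕ → Set) (b≤H : b ≤ H) (¬D[1+b] : ¬ D (suc b))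
                  (D≥1+b : ∀ y → D y → suc b ≤ y) where

  Old Bottom Second Corner New : Region
  Old = Shift 0 2 (HalfHex b (b + m) H (D ∘ (2 +_)))
  Bottom = Shift b 0 (BRow m)
  Second = Shift b 0 (ARow m)
  Corner = CStrip b
  New = HalfHex (suc b) (suc b + m) (2 + H) D

  private
    2*[1+b+m]≡2*[b+m]+2 : ∀ b m → 2 * (1 + b + m) ≡ 2 * (b + m) + 2
    2*[1+b+m]≡2*[b+m]+2 = solve-∀
    shift-west : ∀ X y k → 2 * X + (2 + y) + k ≡ (2 * X + y + k) + 2
    shift-west = solve-∀

  Old⊆New : ∀ τ → Old τ → New τ
  Old⊆New _ (tri up X y , (y<H , SW , west , ¬dent) , refl) =
    s≤s (s≤s y<H) , subst (suc b ≤_) (2+[X+y]≡X+[2+y] X y) (s≤s (≤-trans SW (n≤1+n _))) ,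
    subst₂ _≤_ (sym (shift-west X y 2)) (sym (2*[1+b+m]≡2*[b+m]+2 b m)) (+-monoˡ-≤ 2 west) , ¬dent
  Old⊆New _ (tri down X y , (y<H , SW , west) , refl) =
    s≤s (s≤s y<H) , s≤s (subst (b ≤_) (2+[X+y]≡X+[2+y] X y) (≤-trans SW (n≤1+n _))) ,
    subst₂ _≤_ (sym (shift-west X y 3)) (sym (2*[1+b+m]≡2*[b+m]+2 b m)) (+-monoˡ-≤ 2 west)

  Bottom⊆New : ∀ τ → Bottom τ → New τ
  Bottom⊆New _ (tri up X y , s , refl) with BRow-up⇒ m X y s
  ... | refl , j , refl , j<m =
    s≤s z≤n , +≡⇒≤ j (trans (eq₁ b j) (sym (+-identityʳ _))) ,
    ≤-trans (≤-reflexive (eq₂ b j)) (*-monoʳ-≤ 2 (+-monoʳ-≤ (suc b) j<m)) ,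
    λ (_ , d) → 1+n≰n (≤-trans (D≥1+b 0 d) z≤n)
    where
    eq₁ : ∀ b j → suc b + j ≡ b + suc j
    eq₁ = solve-∀
    eq₂ : ∀ b j → 2 * (b + (1 + j)) + 0 + 2 ≡ 2 * (1 + b + (1 + j))
    eq₂ = solve-∀
  Bottom⊆New _ (tri down X y , s , refl) with BRow-down⇒ m X y s
  ... | refl , X<m =
    s≤s z≤n , s≤s (+≡⇒≤ X (sym (+-identityʳ _))) ,
    ≤-trans (+≡⇒≤ 1 (eq b X)) (*-monoʳ-≤ 2 (+-monoʳ-≤ (suc b) X<m))
    where
    eq : ∀ b x → 2 * (b + x) + 0 + 3 + 1 ≡ 2 * (1 + b + (1 + x))
    eq = solve-∀

  Second⊆New : ∀ τ → Second τ → New τ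
  Second⊆New _ (tri up X y , s , refl) with ARow-up⇒ m X y s
  ... | refl , X<m =
    s≤s (s≤s z≤n) , +≡⇒≤ X (eq₁ b X) ,
    ≤-trans (+≡⇒≤ 1 (eq₂ b X)) (*-monoʳ-≤ 2 (+-monoʳ-≤ (suc b) X<m)) , ¬dent
    where
    eq₁ : ∀ b x → 1 + b + x ≡ b + x + 1
    eq₁ = solve-∀
    eq₂ : ∀ b x → 2 * (b + x) + 1 + 2 + 1 ≡ 2 * (1 + b + (1 + x))
    eq₂ = solve-∀
    ¬dent : ¬ (b + X ≡ 0 × D 1)
    ¬dent (_ , d) with D≥1+b 1 d
    ... | s≤s z≤n = ¬D[1+b] d
  Second⊆New _ (tri down X y , s , refl) with ARow-down⇒ m X y s
  ... | refl , X<m =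
    s≤s (s≤s z≤n) , s≤s (+≡⇒≤ (X + 1) (sym (+-assoc b X 1))) ,
    ≤-trans (≤-reflexive (eq b X)) (*-monoʳ-≤ 2 (+-monoʳ-≤ (suc b) X<m))
    where
    eq : ∀ b x → 2 * (b + x) + 1 + 3 ≡ 2 * (1 + b + (1 + x))
    eq = solve-∀

  Corner⊆New : ∀ τ → Corner τ → New τ
  Corner⊆New = CStrip⊆HalfHex b m H D b≤H ¬D[1+b]

  New[row0]⊆Bottom : ∀ o X → New (tri o X 0) → Bottom (tri o X 0)
  New[row0]⊆Bottom up X (y<H , SW , west , _) with m≤n⇒∃[o]m+o≡n (subst (suc b ≤_) (+-identityʳ X) SW)
  ... | j , refl = (tri up (suc j) 0 ,
        ⇒BRow-up m j (+-cancelˡ-≤ (suc b) (suc j) m (*-cancelˡ-≤ 2 (subst (_≤ 2 * (suc b + m)) (eq b j) west))) ,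
        cong (λ z → tri up z 0) (+-suc b j))
    where
    eq : ∀ b j → 2 * (1 + b + j) + 0 + 2 ≡ 2 * (1 + b + (1 + j))
    eq = solve-∀
  New[row0]⊆Bottom down X (y<H , SW , west) with m≤n⇒∃[o]m+o≡n (subst (b ≤_) (+-identityʳ X) (≤-pred SW))
  ... | X₀ , refl = (tri down X₀ 0 , ⇒BRow-down m X₀ (+-cancelˡ-< (suc b) X₀ m (*-cancelˡ-< 2 _ _
        (subst (_≤ 2 * (suc b + m)) (eq b X₀) west))) , refl)
    where
    eq : ∀ b x → 2 * (b + x) + 0 + 3 ≡ 1 + 2 * (1 + b + x)
    eq = solve-∀
  New[row1]⊆Second∪Corner : ∀ o X → New (tri o X 1) → (Second ∪ Corner) (tri o X 1)
  New[row1]⊆Second∪Corner up X (y<H , SW , west , _) with m≤n⇒∃[o]m+o≡n (≤-pred (subst (suc b ≤_) (+-comm X 1) SW))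
  ... | X₀ , refl = inj₁ (tri up X₀ 1 , ⇒ARow-up m X₀ (+-cancelˡ-< (suc b) X₀ m (*-cancelˡ-< 2 _ _
        (subst (_≤ 2 * (suc b + m)) (eq b X₀) west))) , refl)
    where
    eq : ∀ b x → 2 * (b + x) + 1 + 2 ≡ 1 + 2 * (1 + b + x)
    eq = solve-∀
  New[row1]⊆Second∪Corner down X (y<H , SW , west) with b ≤? X
  ... | yes b≤X with m≤n⇒∃[o]m+o≡n b≤X
  ...   | X₀ , refl = inj₁ (tri down X₀ 1 , ⇒ARow-down m X₀
          (+-cancelˡ-≤ (suc b) (suc X₀) m (*-cancelˡ-≤ 2 (subst (_≤ 2 * (suc b + m)) (eq b X₀) west))) , refl)
    where
    eq : ∀ b x → 2 * (b + x) + 1 + 3 ≡ 2 * (1 + b + (1 + x))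
    eq = solve-∀
  New[row1]⊆Second∪Corner down X (y<H , SW , west) | no b≰X =
    inj₂ (subst (λ z → CStrip z (tri down X 1)) diagonal (⇒CStrip-down X X 0 (+-identityʳ X)))
    where
    diagonal : suc X ≡ b
    diagonal = ≤-antisym (≰⇒> b≰X) (subst (b ≤_) (+-comm X 1) (≤-pred SW))
  New[row≥2]⊆Old∪Corner : ∀ o X y → New (tri o X (2 + y)) → (Old ∪ Corner) (tri o X (2 + y))
  New[row≥2]⊆Old∪Corner up X y (y<H , SW , west , ¬dent) with b ≤? X + y
  ... | yes SW′ = inj₁ (tri up X y , (≤-pred (≤-pred y<H) , SW′ ,
          +-cancelʳ-≤ 2 _ _ (subst₂ _≤_ (shift-west X y 2) (2*[1+b+m]≡2*[b+m]+2 b m) west) , ¬dent) , refl)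
  ... | no ¬SW′ = inj₂ (subst (λ z → CStrip z (tri up X (2 + y))) diagonal (⇒CStrip-up (X + y) X y refl))
    where
    diagonal : suc (X + y) ≡ b
    diagonal = ≤-antisym (≰⇒> ¬SW′) (≤-pred (subst (suc b ≤_) (sym (2+[X+y]≡X+[2+y] X y)) SW))
  New[row≥2]⊆Old∪Corner down X y (y<H , SW , west) with b ≤? suc (X + y)
  ... | yes SW′ = inj₁ (tri down X y , (≤-pred (≤-pred y<H) , SW′ ,
          +-cancelʳ-≤ 2 _ _ (subst₂ _≤_ (shift-west X y 3) (2*[1+b+m]≡2*[b+m]+2 b m) west)) , refl)
  ... | no ¬SW′ = inj₂ (subst (λ z → CStrip z (tri down X (2 + y))) diagonal
                         (⇒CStrip-down (suc (X + y)) X (suc y) (+-suc X y)))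
    where
    diagonal : suc (suc (X + y)) ≡ b
    diagonal = ≤-antisym (≰⇒> ¬SW′) (subst (b ≤_) (sym (2+[X+y]≡X+[2+y] X y)) (≤-pred SW))

  New⊆pieces : ∀ τ → New τ → (((Old ∪ Bottom) ∪ Second) ∪ Corner) τ
  New⊆pieces (tri o X zero) p = inj₁ (inj₁ (inj₂ (New[row0]⊆Bottom o X p)))
  New⊆pieces (tri o X (suc zero)) p = [ inj₁ ∘ inj₂ , inj₂ ]′ (New[row1]⊆Second∪Corner o X p)
  New⊆pieces (tri o X (suc (suc y))) p = [ inj₁ ∘ inj₁ ∘ inj₁ , inj₂ ]′ (New[row≥2]⊆Old∪Corner o X y p)

  Old#Bottom : Disjoint Old Bottom
  Old#Bottom _ (tri up X y , _ , refl) (tri up X₀ y₀ , r , e) with BRow-up⇒ m X₀ y₀ r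
  Old#Bottom _ (tri up X y , _ , refl) (tri up X₀ y₀ , r , ()) | refl , _
  Old#Bottom _ (tri down X y , _ , refl) (tri down X₀ y₀ , r , e) with BRow-down⇒ m X₀ y₀ r
  Old#Bottom _ (tri down X y , _ , refl) (tri down X₀ y₀ , r , ()) | refl , _

  Old∪Bottom#Second : Disjoint (Old ∪ Bottom) Second
  Old∪Bottom#Second _ (inj₁ (tri up X y , _ , refl)) (tri up X₀ y₀ , r , e) with ARow-up⇒ m X₀ y₀ r
  Old∪Bottom#Second _ (inj₁ (tri up X y , _ , refl)) (tri up X₀ y₀ , r , ()) | refl , _
  Old∪Bottom#Second _ (inj₁ (tri down X y , _ , refl)) (tri down X₀ y₀ , r , e) with ARow-down⇒ m X₀ y₀ r
  Old∪Bottom#Second _ (inj₁ (tri down X y , _ , refl)) (tri down X₀ y₀ , r , ()) | refl , _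
  Old∪Bottom#Second _ (inj₂ (tri up X y , q , refl)) (tri up X₀ y₀ , r , e) with BRow-up⇒ m X y q | ARow-up⇒ m X₀ y₀ r
  Old∪Bottom#Second _ (inj₂ (tri up X y , q , refl)) (tri up X₀ y₀ , r , ()) | refl , _ | refl , _
  Old∪Bottom#Second _ (inj₂ (tri down X y , q , refl)) (tri down X₀ y₀ , r , e) with BRow-down⇒ m X y q | ARow-down⇒ m X₀ y₀ r
  Old∪Bottom#Second _ (inj₂ (tri down X y , q , refl)) (tri down X₀ y₀ , r , ()) | refl , _ | refl , _

  pieces⊆New : ∀ τ → (((Old ∪ Bottom) ∪ Second) ∪ Corner) τ → New τ
  pieces⊆New τ (inj₁ (inj₁ (inj₁ p))) = Old⊆New τ p
  pieces⊆New τ (inj₁ (inj₁ (inj₂ p))) = Bottom⊆New τ p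
  pieces⊆New τ (inj₁ (inj₂ p)) = Second⊆New τ p
  pieces⊆New τ (inj₂ p) = Corner⊆New τ p

  New-tiling : LozengeTiling (HalfHex b (b + m) H (D ∘ (2 +_))) → LozengeTiling New
  New-tiling tiling = tiling-resp pieces⊆New New⊆pieces
    (∪-tiling (∪-tiling (∪-tiling (Shift-tiling 0 2 tiling) (Shift-tiling b 0 (BRow-tiling m)) Old#Bottom)
                          (Shift-tiling b 0 (ARow-tiling m)) Old∪Bottom#Second)
              (CStrip-tiling b) (pieces#CStrip b m H D))

HalfHex-add-bottom-rows : ∀ b m H (D : ℕ → Set) → b ≤ H → ¬ D (suc b) → (∀ y → D y → suc b ≤ y) →
  LozengeTiling (HalfHex b (b + m) H (D ∘ (2 +_))) → LozengeTiling (HalfHex (suc b) (suc b + m) (2 + H) D)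
HalfHex-add-bottom-rows b m H D b≤H ¬D[1+b] D≥1+b = BottomRows.New-tiling b m H D b≤H ¬D[1+b] D≥1+b

Increasing : ∀ {n} → (Fin n → ℕ) → Set
Increasing u = ∀ i j → i F.< j → u i < u j

Spread : ∀ {n} → (Fin n → ℕ) → Set
Spread u = ∀ i → 2 * suc (toℕ i) ≤ u i

inject₁<fromℕ : ∀ {n} (j : Fin n) → inject₁ j F.< fromℕ n
inject₁<fromℕ {n} j = subst (toℕ (inject₁ j) <_) (sym (toℕ-fromℕ n)) (inject₁ℕ< j)

Increasing⇒≤last : ∀ {n} (u : Fin (suc n) → ℕ) → Increasing u → ∀ i → u i ≤ u (fromℕ n)
Increasing⇒≤last u u↑ i with view i
... | ‵fromℕ = ≤-refl
... | ‵inject₁ j = <⇒≤ (u↑ _ _ (inject₁<fromℕ j))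

HalfHex-resp-dents : ∀ b c H {D D′ : ℕ → Set} → (∀ y → D y → D′ y) → (∀ y → D′ y → D y) →
  LozengeTiling (HalfHex b c H D) → LozengeTiling (HalfHex b c H D′)
HalfHex-resp-dents b c H D⊆D′ D′⊆D = tiling-resp (resp D′⊆D) (resp D⊆D′)
  where
  resp : ∀ {D D′ : ℕ → Set} → (∀ y → D′ y → D y) → ∀ τ → HalfHex b c H D τ → HalfHex b c H D′ τ
  resp D′⊆D (tri up X y) (y<H , SW , west , ¬dent) = y<H , SW , west , λ (X≡0 , d′) → ¬dent (X≡0 , D′⊆D y d′)
  resp D′⊆D (tri down X y) τ∈R = τ∈R

HalfHexV-suc-b : ∀ a b n (u : Fin n → ℕ) → (∀ i → u i < suc b + 2 * n) →
  LozengeTiling (HalfHexV a b n u) → LozengeTiling (HalfHexV a (suc b) n u)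
HalfHexV-suc-b a b n u u<bound tiling =
  subst (λ c → LozengeTiling (HalfHex (suc b) c H D)) (eq₁ a n b)
    (subst (λ h → LozengeTiling (HalfHex (suc b) (suc b + (a + n)) h D)) (eq₂ b n)
      (HalfHex-add-bottom-rows b (a + n) H′ D b≤H′ ¬D[1+b] D≥1+b
        (HalfHex-resp-dents b (b + (a + n)) H′ shift-dent unshift-dent
          (subst (λ c → LozengeTiling (HalfHex b c H′ (DentRow n u H′))) (+-comm (a + n) b) tiling))))
  where
  H′ = b + b + 2 * n
  H = suc b + suc b + 2 * n
  D = DentRow n u H
  eq₁ : ∀ a n b → suc b + (a + n) ≡ a + n + suc b
  eq₁ = solve-∀
  eq₂ : ∀ b n → 2 + (b + b + 2 * n) ≡ suc b + suc b + 2 * n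
  eq₂ = solve-∀
  eq₃ : ∀ b n → suc b + suc b + 2 * n ≡ suc b + (suc b + 2 * n)
  eq₃ = solve-∀
  b≤H′ : b ≤ H′
  b≤H′ = ≤-trans (m≤m+n b b) (m≤m+n (b + b) (2 * n))
  shift-dent : ∀ y → DentRow n u H′ y → D (2 + y)
  shift-dent y (i , e) = i , trans (cong (2 +_) e) (eq₂ b n)
  unshift-dent : ∀ y → D (2 + y) → DentRow n u H′ y
  unshift-dent y (i , e) = i , suc-injective (suc-injective (trans e (sym (eq₂ b n))))
  ¬D[1+b] : ¬ D (suc b)
  ¬D[1+b] (i , e) = <⇒≢ (u<bound i) (+-cancelˡ-≡ (suc b) (u i) (suc b + 2 * n) (trans e (eq₃ b n)))
  D≥1+b : ∀ y → D y → suc b ≤ y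
  D≥1+b y (i , e) = +-cancelʳ-≤ (suc b + 2 * n) (suc b) y
    (subst (_≤ y + (suc b + 2 * n)) (trans e (eq₃ b n)) (+-monoʳ-≤ y (<⇒≤ (u<bound i))))

HalfHexV-add-last-dent : ∀ a b n (u : Fin (suc n) → ℕ) → u (fromℕ n) ≡ b + 2 * suc n →
  LozengeTiling (HalfHexV a (suc b) n (u ∘ inject₁)) → LozengeTiling (HalfHexV a b (suc n) u)
HalfHexV-add-last-dent a b n u u[last]≡ tiling =
  HalfHex-add-BStrip b c H (DentRow (suc n) u H) (DentRow n (u ∘ inject₁) H)
    (+≡⇒≤ (a + n) (sym (eq₁ a n b))) (≤-trans (m≤m+n b b) (m≤m+n (b + b) _))
    (fromℕ n , trans (cong (b +_) u[last]≡) (sym (+-assoc b b (2 * suc n))))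
    (λ y (j , e) → inject₁ j , e) last-or-earlier
    (subst (λ h → LozengeTiling (HalfHex (suc b) c h (DentRow n (u ∘ inject₁) h))) (eq₂ b n)
      (subst (λ c′ → LozengeTiling (HalfHex (suc b) c′ (suc b + suc b + 2 * n)
                                     (DentRow n (u ∘ inject₁) (suc b + suc b + 2 * n)))) (eq₃ a n b) tiling))
  where
  c = a + suc n + b
  H = b + b + 2 * suc n
  eq₁ : ∀ a n b → a + suc n + b ≡ suc b + (a + n)
  eq₁ = solve-∀
  eq₂ : ∀ b n → suc b + suc b + 2 * n ≡ b + b + 2 * suc n
  eq₂ = solve-∀
  eq₃ : ∀ a n b → a + n + suc b ≡ a + suc n + b
  eq₃ = solve-∀
  last-or-earlier : ∀ y → DentRow (suc n) u H y → DentRow n (u ∘ inject₁) H y ⊎ y ≡ b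
  last-or-earlier y (i , e) with view i
  ... | ‵fromℕ = inj₂ (+-cancelʳ-≡ (u (fromℕ n)) y b
                   (trans e (trans (+-assoc b b (2 * suc n)) (cong (b +_) (sym u[last]≡)))))
  ... | ‵inject₁ j = inj₁ (j , e)

dentless-tiling : ∀ a b (u : Fin 0 → ℕ) → LozengeTiling (HalfHexV a b 0 u)
dentless-tiling a zero u = empty-tiling _ λ { (tri up X y) (() , _) ; (tri down X y) (() , _) }
dentless-tiling a (suc b) u = HalfHexV-suc-b a b 0 u (λ ()) (dentless-tiling a b u)

Spread⇒tiling : ∀ n (u : Fin n → ℕ) a b → (∀ i → u i ≤ b + 2 * n) → Increasing u → Spread u →
  LozengeTiling (HalfHexV a b n u)
Spread⇒tiling zero u a b _ _ _ = dentless-tiling a b u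
Spread⇒tiling (suc n) u a b u≤ u↑ spread = grow b u≤
  where
  inject₁-mono : ∀ i j → i F.< j → inject₁ i F.< inject₁ j
  inject₁-mono i j = subst₂ _<_ (sym (toℕ-inject₁ i)) (sym (toℕ-inject₁ j))
  earlier-spread : Spread (u ∘ inject₁)
  earlier-spread j = subst (λ z → 2 * suc z ≤ u (inject₁ j)) (toℕ-inject₁ j) (spread (inject₁ j))
  u[last]≥ : 2 * suc n ≤ u (fromℕ n)
  u[last]≥ = subst (λ z → 2 * suc z ≤ u (fromℕ n)) (toℕ-fromℕ n) (spread (fromℕ n))

  grow : ∀ b → (∀ i → u i ≤ b + 2 * suc n) → LozengeTiling (HalfHexV a b (suc n) u)
  grow b u≤ with u (fromℕ n) ≟ b + 2 * suc n
  ... | yes u[last]≡ = HalfHexV-add-last-dent a b n u u[last]≡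
    (Spread⇒tiling n (u ∘ inject₁) a (suc b) earlier≤ (λ i j i<j → u↑ _ _ (inject₁-mono i j i<j)) earlier-spread)
    where
    eq : ∀ b n → b + 2 * suc n ≡ suc (suc b + 2 * n)
    eq = solve-∀
    earlier≤ : ∀ j → u (inject₁ j) ≤ suc b + 2 * n
    earlier≤ j = ≤-pred (subst (u (inject₁ j) <_) (trans u[last]≡ (eq b n)) (u↑ _ _ (inject₁<fromℕ j)))
  grow zero u≤ | no u[last]≢ = ⊥-elim (u[last]≢ (≤-antisym (u≤ (fromℕ n)) u[last]≥))
  grow (suc b) u≤ | no u[last]≢ = HalfHexV-suc-b a b (suc n) u u<bound (grow b (λ i → ≤-pred (u<bound i)))
    where
    u<bound : ∀ i → u i < suc b + 2 * suc n
    u<bound i = ≤-<-trans (Increasing⇒≤last u u↑ i) (≤∧≢⇒< (u≤ (fromℕ n)) u[last]≢)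

-- Counting triangles row by row

row : ℕ → ℕ → ℕ
row H s = H ∸ suc s

row-injective : ∀ H s s′ → s < H → s′ < H → row H s ≡ row H s′ → s ≡ s′
row-injective H s s′ s<H s′<H e = suc-injective (∸-cancelˡ-≡ s<H s′<H e)

row-involutive : ∀ H y → y < H → row H (row H y) ≡ y
row-involutive H y y<H = trans (sym (pred[m∸n]≡m∸[1+n] H (H ∸ suc y))) (cong pred (m∸[m∸n]≡n y<H))

row<H : ∀ H s → s < H → row H s < H
row<H (suc H) s (s≤s s≤H) = s≤s (m∸n≤m H s)

coverCount≡listSum : ∀ τ ls → coverCount τ ls ≡ listSum ls (λ l → ind (covers l τ))
coverCount≡listSum τ [] = refl
coverCount≡listSum τ (l ∷ ls) = cong (ind (covers l τ) +_) (coverCount≡listSum τ ls)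

covers-up : ∀ l X y → ind (covers l (tri up X y)) ≡ ind (tri≡ᵇ (upTri l) (tri up X y))
covers-up (lozA _ _) X y = cong ind (∨-identityʳ _)
covers-up (lozB _ _) X y = cong ind (∨-identityʳ _)
covers-up (lozC _ _) X y = cong ind (∨-identityʳ _)

covers-down : ∀ l X y → ind (covers l (tri down X y)) ≡ ind (tri≡ᵇ (downTri l) (tri down X y))
covers-down (lozA _ _) X y = refl
covers-down (lozB _ _) X y = refl
covers-down (lozC _ _) X y = refl

downTri-row≤upTri-row : ∀ l → py (downTri l) ≤ py (upTri l)
downTri-row≤upTri-row (lozA x y) = ≤-refl
downTri-row≤upTri-row (lozB x y) = ≤-refl
downTri-row≤upTri-row (lozC x y) = n≤1+n y

upTri-η : ∀ l → upTri l ≡ tri up (px (upTri l)) (py (upTri l))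
upTri-η (lozA x y) = refl
upTri-η (lozB x y) = refl
upTri-η (lozC x y) = refl

downTri-η : ∀ l → downTri l ≡ tri down (px (downTri l)) (py (downTri l))
downTri-η (lozA x y) = refl
downTri-η (lozB x y) = refl
downTri-η (lozC x y) = refl

-- The box is 0 ≤ X < W, H - k ≤ y < H; count o ls counts the o-triangles covered by ls in it.
module TopRows (W H k : ℕ) (k≤H : k ≤ H) where

  boxRow : Orient → Tri → ℕ → ℕ
  boxRow o σ y = Σ< W (λ X → ind (tri≡ᵇ σ (tri o X y)))

  inBox : Orient → Tri → ℕ
  inBox o σ = Σ< k (λ s → boxRow o σ (row H s))

  count : Orient → List Loz → ℕ
  count o ls = Σ< k (λ s → Σ< W (λ X → coverCount (tri o X (row H s)) ls))

  boxRow≤1 : ∀ o σ y → boxRow o σ y ≤ 1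
  boxRow≤1 o σ y = Σ<≤1 W _ (λ X _ → ind≤1 _) λ x x′ _ _ p q →
    cong px (trans (sym (tri≡ᵇ⇒≡ σ (tri o x y) (1≤ind⇒T p))) (tri≡ᵇ⇒≡ σ (tri o x′ y) (1≤ind⇒T q)))

  1≤boxRow⇒ : ∀ o σ y → 1 ≤ boxRow o σ y → Σ[ X ∈ ℕ ] (σ ≡ tri o X y)
  1≤boxRow⇒ o σ y p with Σ<-positive W _ p
  ... | X , _ , q = X , tri≡ᵇ⇒≡ σ (tri o X y) (1≤ind⇒T q)

  inBox≤1 : ∀ o σ → inBox o σ ≤ 1
  inBox≤1 o σ = Σ<≤1 k _ (λ s _ → boxRow≤1 o σ (row H s)) same-row
    where
    same-row : ∀ s s′ → s < k → s′ < k → 1 ≤ boxRow o σ (row H s) → 1 ≤ boxRow o σ (row H s′) → s ≡ s′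
    same-row s s′ s<k s′<k p p′ with 1≤boxRow⇒ o σ (row H s) p | 1≤boxRow⇒ o σ (row H s′) p′
    ... | X , e | X′ , e′ =
      row-injective H s s′ (≤-trans s<k k≤H) (≤-trans s′<k k≤H) (trans (sym (cong py e)) (cong py e′))

  1≤inBox : ∀ o X y → X < W → y < H → row H y < k → 1 ≤ inBox o (tri o X y)
  1≤inBox o X y X<W y<H top = ≤-trans in-row (subst (λ z → boxRow o σ z ≤ inBox o σ) (row-involutive H y y<H)
                                                    (term≤Σ< k (λ s → boxRow o σ (row H s)) (row H y) top))
    where
    σ = tri o X y
    in-row : 1 ≤ boxRow o σ y
    in-row = subst (λ b → ind b ≤ boxRow o σ y) (tri≡ᵇ-refl σ) (term≤Σ< W (λ X′ → ind (tri≡ᵇ σ (tri o X′ y))) X X<W)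

  1≤inBox⇒ : ∀ o σ → 1 ≤ inBox o σ → Σ[ s ∈ ℕ ] (s < k × py σ ≡ row H s)
  1≤inBox⇒ o σ p with Σ<-positive k _ p
  ... | s , s<k , q with 1≤boxRow⇒ o σ (row H s) q
  ...   | X , e = s , s<k , cong py e

  count≡ : ∀ o ls (tri-of : Loz → Tri) → (∀ l X y → ind (covers l (tri o X y)) ≡ ind (tri≡ᵇ (tri-of l) (tri o X y))) →
    count o ls ≡ listSum ls (λ l → inBox o (tri-of l))
  count≡ o ls tri-of covers≡ =
    begin
      count o ls
    ≡⟨ Σ<-cong k (λ s _ → trans (Σ<-cong W (λ X _ → coverCount≡listSum (tri o X (row H s)) ls))
                                 (Σ<-listSum-comm W ls (λ X l → ind (covers l (tri o X (row H s)))))) ⟩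
      Σ< k (λ s → listSum ls (λ l → Σ< W (λ X → ind (covers l (tri o X (row H s))))))
    ≡⟨ Σ<-listSum-comm k ls (λ s l → Σ< W (λ X → ind (covers l (tri o X (row H s))))) ⟩
      listSum ls (λ l → Σ< k (λ s → Σ< W (λ X → ind (covers l (tri o X (row H s))))))
    ≡⟨ listSum-cong ls (λ l → Σ<-cong k (λ s _ → Σ<-cong W (λ X _ → covers≡ l X (row H s)))) ⟩
      listSum ls (λ l → inBox o (tri-of l))
    ∎
    where open ≡-Reasoning

-- A lozenge whose down triangle lies in the top k rows has its up triangle there too.
topRows-down≤up : ∀ W H k (k≤H : k ≤ H) ls → All (λ l → px (upTri l) < W × py (upTri l) < H) ls →
  TopRows.count W H k k≤H down ls ≤ TopRows.count W H k k≤H up ls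
topRows-down≤up W H k k≤H ls ups-in-box =
  subst₂ _≤_ (sym (count≡ down ls downTri covers-down)) (sym (count≡ up ls upTri covers-up))
    (listSum-mono ls ups-in-box per-lozenge)
  where
  open TopRows W H k k≤H
  per-lozenge : ∀ l → px (upTri l) < W × py (upTri l) < H → inBox down (downTri l) ≤ inBox up (upTri l)
  per-lozenge l (X<W , y<H) with inBox down (downTri l) in e
  ... | zero = z≤n
  ... | suc _ with 1≤inBox⇒ down (downTri l) (subst (1 ≤_) (sym e) (s≤s z≤n))
  ...   | s , s<k , y≡ = subst (_≤ inBox up (upTri l)) e (≤-trans (inBox≤1 down (downTri l))
          (subst (λ t → 1 ≤ inBox up t) (sym (upTri-η l)) (1≤inBox up _ _ X<W y<H up-in-top)))
    where
    up-in-top : row H (py (upTri l)) < k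
    up-in-top = ≤-<-trans (∸-monoʳ-≤ H (s≤s (downTri-row≤upTri-row l)))
      (subst (λ z → row H z < k) (sym y≡) (subst (_< k) (sym (row-involutive H s (≤-trans s<k k≤H))) s<k))

allRows-up≤down : ∀ W H ls → All (λ l → px (downTri l) < W × py (downTri l) < H) ls →
  TopRows.count W H H ≤-refl up ls ≤ TopRows.count W H H ≤-refl down ls
allRows-up≤down W H ls downs-in-box =
  subst₂ _≤_ (sym (count≡ up ls upTri covers-up)) (sym (count≡ down ls downTri covers-down))
    (listSum-mono ls downs-in-box per-lozenge)
  where
  open TopRows W H H ≤-refl
  per-lozenge : ∀ l → px (downTri l) < W × py (downTri l) < H → inBox up (upTri l) ≤ inBox down (downTri l)
  per-lozenge l (X<W , y<H) = ≤-trans (inBox≤1 up (upTri l))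
    (subst (λ t → 1 ≤ inBox down t) (sym (downTri-η l)) (1≤inBox down _ _ X<W y<H (row<H H _ y<H)))

evenInd : ℕ → ℕ
evenInd zero = 1
evenInd (suc zero) = 0
evenInd (suc (suc y)) = evenInd y

evenInd-view : ∀ y → (evenInd y ≡ 1 × Σ[ j ∈ ℕ ] (y ≡ 2 * j)) ⊎ (evenInd y ≡ 0 × Σ[ j ∈ ℕ ] (y ≡ suc (2 * j)))
evenInd-view zero = inj₁ (refl , 0 , refl)
evenInd-view (suc zero) = inj₂ (refl , 0 , refl)
evenInd-view (suc (suc y)) with evenInd-view y
... | inj₁ (e , j , refl) = inj₁ (e , suc j , eq j)
  where
  eq : ∀ j → 2 + 2 * j ≡ 2 * suc j
  eq = solve-∀
... | inj₂ (e , j , refl) = inj₂ (e , suc j , cong suc (eq j))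
  where
  eq : ∀ j → 2 + 2 * j ≡ 2 * suc j
  eq = solve-∀

2*m<2*n⇒2*m+2≤2*n : ∀ m n → 2 * m + 1 ≤ 2 * n → 2 * m + 2 ≤ 2 * n
2*m<2*n⇒2*m+2≤2*n m n p =
  subst (_≤ 2 * n) (eq m) (*-monoʳ-≤ 2 (*-cancelˡ-< 2 m n (subst (_≤ 2 * n) (+-comm (2 * m) 1) p)))
  where
  eq : ∀ m → 2 * suc m ≡ 2 * m + 2
  eq = solve-∀

χ[b≤y]+χ[y<b]≡1 : ∀ b y → χ (b ≤? y) + χ (suc y ≤? b) ≡ 1
χ[b≤y]+χ[y<b]≡1 b y = χ-complement (b ≤? y) (suc y ≤? b) (λ b≤y y<b → n≮n y (≤-trans y<b b≤y)) ≰⇒>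

-- Row y starts, on the south-west side, with a down triangle exactly when y < b, and the
-- line L ends it with an up triangle exactly when y is even.
module RowBalance (b c H : ℕ) (b≤c : b ≤ c) (H≤2c : H ≤ 2 * c) (b≤H : b ≤ H) where

  UpIn DownIn : ℕ → ℕ → Set
  UpIn X y = suc y ≤ H × b ≤ X + y × 2 * X + y + 2 ≤ 2 * c
  DownIn X y = suc y ≤ H × b ≤ suc (X + y) × 2 * X + y + 3 ≤ 2 * c

  UpIn? : ∀ X y → Dec (UpIn X y)
  UpIn? X y = (suc y ≤? H) ×-dec ((b ≤? X + y) ×-dec (2 * X + y + 2 ≤? 2 * c))

  DownIn? : ∀ X y → Dec (DownIn X y)
  DownIn? X y = (suc y ≤? H) ×-dec ((b ≤? suc (X + y)) ×-dec (2 * X + y + 3 ≤? 2 * c))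

  upCells downCells : ℕ → ℕ
  upCells y = Σ< (suc c) (λ X → χ (UpIn? X y))
  downCells y = Σ< (suc c) (λ X → χ (DownIn? X y))

  ¬DownIn-c : ∀ y → ¬ DownIn c y
  ¬DownIn-c y (_ , _ , west) = n≮n (2 * c) (<-≤-trans (+≡⇒≤ (y + 2) (eq c y)) west)
    where
    eq : ∀ c y → suc (2 * c) + (y + 2) ≡ 2 * c + y + 3
    eq = solve-∀

  SWend-cells : ∀ y → Σ< (suc c) (λ X → χ (suc (X + y) ≟ b)) ≡ χ (suc y ≤? b)
  SWend-cells y = count (suc y ≤? b)
    where
    count : (d : Dec (suc y ≤ b)) → Σ< (suc c) (λ X → χ (suc (X + y) ≟ b)) ≡ χ d
    count (yes y<b) = ≤-antisym (Σ<≤1 (suc c) (λ X → χ (suc (X + y) ≟ b)) (λ X _ → χ≤1 (suc (X + y) ≟ b)) unique)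
          (≤-trans (≤-reflexive (sym (χ-yes (suc (X₀ + y) ≟ b) X₀-hits)))
                   (term≤Σ< (suc c) (λ X → χ (suc (X + y) ≟ b)) X₀ (s≤s (≤-trans (m∸n≤m b (suc y)) b≤c))))
      where
      X₀ = b ∸ suc y
      X₀-hits : suc (X₀ + y) ≡ b
      X₀-hits = trans (sym (+-suc X₀ y)) (m∸n+n≡m y<b)
      unique : ∀ x x′ → x < suc c → x′ < suc c → 1 ≤ χ (suc (x + y) ≟ b) → 1 ≤ χ (suc (x′ + y) ≟ b) → x ≡ x′
      unique x x′ _ _ p p′ =
        +-cancelʳ-≡ y x x′ (suc-injective (trans (1≤χ⇒ (suc (x + y) ≟ b) p) (sym (1≤χ⇒ (suc (x′ + y) ≟ b) p′))))
    count (no y≮b) = Σ<≡0 (suc c) _ λ X _ → χ-no (suc (X + y) ≟ b) (λ e → y≮b (subst (suc y ≤_) e (s≤s (m≤n+m y X))))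

  even-row-balance : ∀ j → 2 * j < H → upCells (2 * j) + χ (suc (2 * j) ≤? b) ≡ downCells (2 * j) + 1
  even-row-balance j y<H =
    begin
      χ (UpIn? 0 y) + Σ< c (λ X → χ (UpIn? (suc X) y)) + χ (suc y ≤? b)
    ≡⟨ cong (_+ χ (suc y ≤? b)) (cong₂ _+_ (χ-cong (proj₁ ∘ proj₂) west-end (UpIn? 0 y) (b ≤? y))
                                            (Σ<-cong c (λ X _ → χ-cong (UpIn⇒DownIn X) (DownIn⇒UpIn X) (UpIn? (suc X) y) (DownIn? X y)))) ⟩
      χ (b ≤? y) + S + χ (suc y ≤? b)
    ≡⟨ eq (χ (b ≤? y)) S (χ (suc y ≤? b)) ⟩
      S + (χ (b ≤? y) + χ (suc y ≤? b))
    ≡⟨ cong (S +_) (χ[b≤y]+χ[y<b]≡1 b y) ⟩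
      S + 1
    ≡⟨ cong (_+ 1) (sym (+-identityʳ S)) ⟩
      S + 0 + 1
    ≡⟨ cong (λ z → S + z + 1) (sym (χ-no (DownIn? c y) (¬DownIn-c y))) ⟩
      S + χ (DownIn? c y) + 1
    ≡⟨ cong (_+ 1) (sym (Σ<-suc c (λ X → χ (DownIn? X y)))) ⟩
      downCells y + 1
    ∎
    where
    open ≡-Reasoning
    y = 2 * j
    S = Σ< c (λ X → χ (DownIn? X y))
    eq : ∀ a s l → a + s + l ≡ s + (a + l)
    eq = solve-∀
    eq₁ : ∀ X j → 2 * X + 2 * j + 3 ≡ 2 * (X + j + 1) + 1
    eq₁ = solve-∀
    eq₂ : ∀ X j → 2 * (1 + X) + 2 * j + 2 ≡ 2 * (X + j + 1) + 2
    eq₂ = solve-∀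
    eq₃ : ∀ X y → 2 * (1 + X) + y + 2 ≡ 2 * X + y + 3 + 1
    eq₃ = solve-∀
    DownIn⇒UpIn : ∀ X → DownIn X y → UpIn (suc X) y
    DownIn⇒UpIn X (y<H , SW , west) = y<H , SW ,
      subst (_≤ 2 * c) (sym (eq₂ X j)) (2*m<2*n⇒2*m+2≤2*n (X + j + 1) c (subst (_≤ 2 * c) (eq₁ X j) west))
    UpIn⇒DownIn : ∀ X → UpIn (suc X) y → DownIn X y
    UpIn⇒DownIn X (y<H , SW , west) = y<H , SW , ≤-trans (+≡⇒≤ 1 refl) (subst (_≤ 2 * c) (eq₃ X y) west)
    west-end : b ≤ y → UpIn 0 y
    west-end b≤y = y<H , b≤y , 2*m<2*n⇒2*m+2≤2*n j c (≤-trans (subst (_≤ H) (+-comm 1 (2 * j)) y<H) H≤2c)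

  odd-row-balance : ∀ j → suc (2 * j) < H → upCells (suc (2 * j)) + χ (suc (suc (2 * j)) ≤? b) ≡ downCells (suc (2 * j)) + 0
  odd-row-balance j y<H =
    begin
      upCells y + χ (suc y ≤? b)
    ≡⟨ cong (upCells y +_) (sym (SWend-cells y)) ⟩
      upCells y + Σ< (suc c) (λ X → χ (suc (X + y) ≟ b))
    ≡⟨ sym (Σ<-+ (suc c) (λ X → χ (UpIn? X y)) (λ X → χ (suc (X + y) ≟ b))) ⟩
      Σ< (suc c) (λ X → χ (UpIn? X y) + χ (suc (X + y) ≟ b))
    ≡⟨ Σ<-cong (suc c) (λ X _ → sym (χ-disjoint-⊎ (DownIn⇒ X) (UpIn⇒DownIn X) (SWend⇒DownIn X) (UpIn#SWend X)
                                                   (DownIn? X y) (UpIn? X y) (suc (X + y) ≟ b))) ⟩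
      downCells y
    ≡⟨ sym (+-identityʳ _) ⟩
      downCells y + 0
    ∎
    where
    open ≡-Reasoning
    y = suc (2 * j)
    eq₁ : ∀ X j → 2 * X + (1 + 2 * j) + 2 ≡ 2 * (X + j + 1) + 1
    eq₁ = solve-∀
    eq₂ : ∀ X j → 2 * X + (1 + 2 * j) + 3 ≡ 2 * (X + j + 1) + 2
    eq₂ = solve-∀
    eq₃ : ∀ X y → 2 * X + y + 3 + (1 + y) ≡ 2 * (1 + (X + y)) + 2
    eq₃ = solve-∀
    DownIn⇒ : ∀ X → DownIn X y → UpIn X y ⊎ suc (X + y) ≡ b
    DownIn⇒ X (y<H , SW , west) with b ≤? X + y
    ... | yes SW′ = inj₁ (y<H , SW′ , ≤-trans (+≡⇒≤ 1 (+-assoc (2 * X + y) 2 1)) west)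
    ... | no ¬SW′ = inj₂ (≤-antisym (≰⇒> ¬SW′) SW)
    UpIn⇒DownIn : ∀ X → UpIn X y → DownIn X y
    UpIn⇒DownIn X (y<H , SW , west) = y<H , ≤-trans SW (n≤1+n _) ,
      subst (_≤ 2 * c) (sym (eq₂ X j)) (2*m<2*n⇒2*m+2≤2*n (X + j + 1) c (subst (_≤ 2 * c) (eq₁ X j) west))
    SWend⇒DownIn : ∀ X → suc (X + y) ≡ b → DownIn X y
    SWend⇒DownIn X e = ≤-trans (s≤s (m≤n+m y X)) (subst (_≤ H) (sym e) b≤H) , ≤-reflexive (sym e) ,
      +-cancelʳ-≤ (1 + y) _ _ (subst (_≤ 2 * c + (1 + y)) (sym (eq₃ X y))
        (subst (λ z → 2 * z + 2 ≤ 2 * c + (1 + y)) (sym e)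
          (≤-trans (+-monoˡ-≤ 2 (*-monoʳ-≤ 2 b≤c)) (+-monoʳ-≤ (2 * c) (s≤s (s≤s z≤n))))))
    UpIn#SWend : ∀ X → UpIn X y → suc (X + y) ≡ b → ⊥
    UpIn#SWend X (_ , SW , _) e = n≮n (X + y) (subst (_≤ X + y) (sym e) SW)

  row-balance : ∀ y → y < H → upCells y + χ (suc y ≤? b) ≡ downCells y + evenInd y
  row-balance y y<H with evenInd-view y
  ... | inj₁ (e , j , refl) = trans (even-row-balance j y<H) (cong (downCells (2 * j) +_) (sym e))
  ... | inj₂ (e , j , refl) = trans (odd-row-balance j y<H) (cong (downCells (suc (2 * j)) +_) (sym e))

module TiledRows (b c H : ℕ) (D : ℕ → Set) (D? : ∀ y → Dec (D y))
                 (b≤c : b ≤ c) (H≤2c : H ≤ 2 * c) (b≤H : b ≤ H) (ls : List Loz)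
                 (ls⊆R : All (LozengeIn (HalfHex b c H D)) ls)
                 (cov : ∀ τ → HalfHex b c H D τ → coverCount τ ls ≡ 1) where

  open RowBalance b c H b≤c H≤2c b≤H public

  R : Region
  R = HalfHex b c H D

  DentIn : ℕ → Set
  DentIn y = D y × UpIn 0 y

  DentIn? : ∀ y → Dec (DentIn y)
  DentIn? y = D? y ×-dec UpIn? 0 y

  dentInd belowB : ℕ → ℕ
  dentInd y = χ (DentIn? y)
  belowB y = χ (suc y ≤? b)

  upCovered downCovered : ℕ → ℕ
  upCovered y = Σ< (suc c) (λ X → coverCount (tri up X y) ls)
  downCovered y = Σ< (suc c) (λ X → coverCount (tri down X y) ls)

  coverCount≡χ : ∀ τ {P : Set} (d : Dec P) → (P → R τ) → (R τ → P) → coverCount τ ls ≡ χ d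
  coverCount≡χ τ (yes p) P⇒R _ = cov τ (P⇒R p)
  coverCount≡χ τ (no ¬p) _ R⇒P = coverCount-outside R ls τ ls⊆R (¬p ∘ R⇒P)

  downCovered≡downCells : ∀ y → downCovered y ≡ downCells y
  downCovered≡downCells y = Σ<-cong (suc c) (λ X _ → coverCount≡χ (tri down X y) (DownIn? X y) (λ r → r) (λ r → r))

  west-end-balance : ∀ y → coverCount (tri up 0 y) ls + dentInd y ≡ χ (UpIn? 0 y)
  west-end-balance y = trans (cong (_+ dentInd y) (coverCount≡χ (tri up 0 y) undented undented⇒R R⇒undented))
    (sym (χ-disjoint-⊎ split proj₁ proj₂ (λ (_ , ¬d) (d , _) → ¬d d) (UpIn? 0 y) undented (DentIn? y)))
    where
    undented = UpIn? 0 y ×-dec ¬? (D? y)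
    undented⇒R : UpIn 0 y × ¬ D y → R (tri up 0 y)
    undented⇒R ((y<H , SW , west) , ¬d) = y<H , SW , west , ¬d ∘ proj₂
    R⇒undented : R (tri up 0 y) → UpIn 0 y × ¬ D y
    R⇒undented (y<H , SW , west , ¬dent) = (y<H , SW , west) , λ d → ¬dent (refl , d)
    split : UpIn 0 y → (UpIn 0 y × ¬ D y) ⊎ DentIn y
    split p with D? y
    ... | yes d = inj₂ (d , p)
    ... | no ¬d = inj₁ (p , ¬d)

  upCovered+dentInd≡upCells : ∀ y → upCovered y + dentInd y ≡ upCells y
  upCovered+dentInd≡upCells y =
    trans (+-swapʳ (coverCount (tri up 0 y) ls) _ (dentInd y))
      (cong₂ _+_ (west-end-balance y)
                 (Σ<-cong c (λ X _ → coverCount≡χ (tri up (suc X) y) (UpIn? (suc X) y)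
                                        (λ (y<H , SW , west) → y<H , SW , west , λ { (() , _) })
                                        (λ (y<H , SW , west , _) → y<H , SW , west))))
    where
    +-swapʳ : ∀ a s d → a + s + d ≡ a + d + s
    +-swapʳ = solve-∀

  covered-row-balance : ∀ y → y < H → upCovered y + dentInd y + belowB y ≡ downCovered y + evenInd y
  covered-row-balance y y<H =
    trans (cong (_+ belowB y) (upCovered+dentInd≡upCells y))
      (trans (row-balance y y<H) (cong (_+ evenInd y) (sym (downCovered≡downCells y))))

  westOfL⇒X<1+c : ∀ X y k → 2 * X + y + k ≤ 2 * c → X < suc c
  westOfL⇒X<1+c X y k west = s≤s (*-cancelˡ-≤ 2 (≤-trans (≤-trans (m≤m+n (2 * X) y) (m≤m+n (2 * X + y) k)) west))

  ups-in-box : All (λ l → px (upTri l) < suc c × py (upTri l) < H) ls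
  ups-in-box = All.map (λ {l} → in-box l) ls⊆R
    where
    in-box : ∀ l → LozengeIn R l → px (upTri l) < suc c × py (upTri l) < H
    in-box (lozA x y) ((y<H , _ , west , _) , _) = westOfL⇒X<1+c x y 2 west , y<H
    in-box (lozB x y) ((y<H , _ , west , _) , _) = westOfL⇒X<1+c (suc x) y 2 west , y<H
    in-box (lozC x y) ((y<H , _ , west , _) , _) = westOfL⇒X<1+c x (suc y) 2 west , y<H

  downs-in-box : All (λ l → px (downTri l) < suc c × py (downTri l) < H) ls
  downs-in-box = All.map (λ {l} → in-box l) ls⊆R
    where
    in-box : ∀ l → LozengeIn R l → px (downTri l) < suc c × py (downTri l) < H
    in-box (lozA x y) (_ , (y<H , _ , west)) = westOfL⇒X<1+c x y 3 west , y<H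
    in-box (lozB x y) (_ , (y<H , _ , west)) = westOfL⇒X<1+c x y 3 west , y<H
    in-box (lozC x y) (_ , (y<H , _ , west)) = westOfL⇒X<1+c x y 3 west , y<H

  Σtop : ℕ → (ℕ → ℕ) → ℕ
  Σtop k f = Σ< k (f ∘ row H)

  top-rows-balance : ∀ k → k ≤ H →
    Σtop k upCovered + Σtop k dentInd + Σtop k belowB ≡ Σtop k downCovered + Σtop k evenInd
  top-rows-balance k k≤H =
    begin
      Σtop k upCovered + Σtop k dentInd + Σtop k belowB
    ≡⟨ cong (_+ Σtop k belowB) (sym (Σ<-+ k _ _)) ⟩
      Σ< k (λ s → upCovered (row H s) + dentInd (row H s)) + Σtop k belowB
    ≡⟨ sym (Σ<-+ k _ _) ⟩
      Σ< k (λ s → upCovered (row H s) + dentInd (row H s) + belowB (row H s))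
    ≡⟨ Σ<-cong k (λ s s<k → covered-row-balance (row H s) (row<H H s (≤-trans s<k k≤H))) ⟩
      Σ< k (λ s → downCovered (row H s) + evenInd (row H s))
    ≡⟨ Σ<-+ k _ _ ⟩
      Σtop k downCovered + Σtop k evenInd
    ∎
    where open ≡-Reasoning

  top-rows-bound : ∀ k → k ≤ H → Σtop k dentInd + Σtop k belowB ≤ Σtop k evenInd
  top-rows-bound k k≤H = +-cancelˡ-≤ (Σtop k upCovered) _ _ (begin
      Σtop k upCovered + (Σtop k dentInd + Σtop k belowB)
    ≡⟨ sym (+-assoc (Σtop k upCovered) (Σtop k dentInd) (Σtop k belowB)) ⟩
      Σtop k upCovered + Σtop k dentInd + Σtop k belowB
    ≡⟨ top-rows-balance k k≤H ⟩
      Σtop k downCovered + Σtop k evenInd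
    ≤⟨ +-monoˡ-≤ (Σtop k evenInd) (topRows-down≤up (suc c) H k k≤H ls ups-in-box) ⟩
      Σtop k upCovered + Σtop k evenInd
    ∎)
    where open ≤-Reasoning

  all-rows-bound : Σtop H evenInd ≤ Σtop H dentInd + Σtop H belowB
  all-rows-bound = +-cancelˡ-≤ (Σtop H downCovered) _ _ (begin
      Σtop H downCovered + Σtop H evenInd
    ≡⟨ sym (top-rows-balance H ≤-refl) ⟩
      Σtop H upCovered + Σtop H dentInd + Σtop H belowB
    ≤⟨ +-monoˡ-≤ (Σtop H belowB) (+-monoˡ-≤ (Σtop H dentInd) (allRows-up≤down (suc c) H ls downs-in-box)) ⟩
      Σtop H downCovered + Σtop H dentInd + Σtop H belowB
    ≡⟨ +-assoc (Σtop H downCovered) (Σtop H dentInd) (Σtop H belowB) ⟩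
      Σtop H downCovered + (Σtop H dentInd + Σtop H belowB)
    ∎)
    where open ≤-Reasoning

double : ℕ → ℕ
double zero = 0
double (suc m) = suc (suc (double m))

double≡ : ∀ m → double m ≡ m + m
double≡ zero = refl
double≡ (suc m) = cong suc (trans (cong suc (double≡ m)) (sym (+-suc m m)))

evenInd-double : ∀ m → evenInd (double m) ≡ 1
evenInd-double zero = refl
evenInd-double (suc m) = evenInd-double m

evenInd-suc-double : ∀ m → evenInd (suc (double m)) ≡ 0
evenInd-suc-double zero = refl
evenInd-suc-double (suc m) = evenInd-suc-double m

Σ-evenInd-all-rows : ∀ h → Σ< (double h) (λ s → evenInd (row (double h) s)) ≡ h
Σ-evenInd-all-rows zero = refl
Σ-evenInd-all-rows (suc h)
  rewrite evenInd-suc-double h | evenInd-double h | Σ-evenInd-all-rows h = refl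

Σ-evenInd-top-rows : ∀ h k → k ≤ double h → 2 * Σ< k (λ s → evenInd (row (double h) s)) ≤ k
Σ-evenInd-top-rows h zero _ = z≤n
Σ-evenInd-top-rows (suc h) (suc zero) _ rewrite evenInd-suc-double h = z≤n
Σ-evenInd-top-rows (suc h) (suc (suc k)) (s≤s (s≤s k≤2h)) rewrite evenInd-suc-double h | evenInd-double h =
  subst (_≤ suc (suc k)) (sym (eq (Σ< k (λ s → evenInd (row (double h) s))))) (s≤s (s≤s (Σ-evenInd-top-rows h k k≤2h)))
  where
  eq : ∀ x → 2 * (0 + (1 + x)) ≡ 2 + 2 * x
  eq = solve-∀

dent-rows≤ : ∀ H K → K ≤ H → ∀ m (w : Fin m → ℕ) (d : ∀ s → Dec (Σ[ j ∈ Fin m ] (row H s + w j ≡ H))) →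
  Σ< K (χ ∘ d) ≤ m
dent-rows≤ H K K≤H zero w d = ≤-reflexive (Σ<≡0 K _ (λ s _ → χ-no (d s) (λ ())))
dent-rows≤ H K K≤H (suc m) w d =
  begin
    Σ< K (χ ∘ d)
  ≤⟨ Σ<-mono K (λ s _ → χ-⊎-≤ first-or-later (d s) (row H s + w F.zero ≟ H) (d′ s)) ⟩
    Σ< K (λ s → χ (row H s + w F.zero ≟ H) + χ (d′ s))
  ≡⟨ Σ<-+ K _ _ ⟩
    Σ< K (λ s → χ (row H s + w F.zero ≟ H)) + Σ< K (χ ∘ d′)
  ≤⟨ +-mono-≤ first-hits-once (dent-rows≤ H K K≤H m (w ∘ F.suc) d′) ⟩
    1 + m
  ∎
  where
  open ≤-Reasoning
  d′ : ∀ s → Dec (Σ[ j ∈ Fin m ] (row H s + w (F.suc j) ≡ H))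
  d′ s = any? (λ j → row H s + w (F.suc j) ≟ H)
  first-or-later : ∀ {s} → Σ[ j ∈ Fin (suc m) ] (row H s + w j ≡ H) →
    (row H s + w F.zero ≡ H) ⊎ Σ[ j ∈ Fin m ] (row H s + w (F.suc j) ≡ H)
  first-or-later (F.zero , e) = inj₁ e
  first-or-later (F.suc j , e) = inj₂ (j , e)
  first-hits-once : Σ< K (λ s → χ (row H s + w F.zero ≟ H)) ≤ 1
  first-hits-once = Σ<≤1 K _ (λ s _ → χ≤1 (row H s + w F.zero ≟ H)) λ s s′ s<K s′<K p p′ →
    row-injective H s s′ (≤-trans s<K K≤H) (≤-trans s′<K K≤H)
      (+-cancelʳ-≡ (w F.zero) _ _ (trans (1≤χ⇒ (_ ≟ H) p) (sym (1≤χ⇒ (_ ≟ H) p′))))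

Increasing⇒hits≤Σ< : ∀ {n} (u : Fin n → ℕ) (g : ℕ → ℕ) → Increasing u → (∀ j → 1 ≤ u j) →
  (∀ j → 1 ≤ g (pred (u j))) → ∀ i → suc (toℕ i) ≤ Σ< (u i) g
Increasing⇒hits≤Σ< {n} u g u↑ u≥1 hit i = hits (toℕ i) i refl
  where
  hit≤Σ< : ∀ j → g (pred (u j)) + Σ< (pred (u j)) g ≤ Σ< (u j) g
  hit≤Σ< j with u j | u≥1 j
  ... | suc v | _ = ≤-reflexive (trans (+-comm (g v) _) (sym (Σ<-suc v g)))
  hits : ∀ m (i : Fin n) → toℕ i ≡ m → suc m ≤ Σ< (u i) g
  hits zero i _ = ≤-trans (≤-trans (hit i) (m≤m+n _ _)) (hit≤Σ< i)
  hits (suc m) (F.suc i′) e = ≤-trans (+-mono-≤ (hit (F.suc i′)) (≤-trans previous-hits (Σ<-mono-range g previous<)))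
                                       (hit≤Σ< (F.suc i′))
    where
    previous-hits : suc m ≤ Σ< (u (inject₁ i′)) g
    previous-hits = hits m (inject₁ i′) (trans (toℕ-inject₁ i′) (suc-injective e))
    previous< : u (inject₁ i′) ≤ pred (u (F.suc i′))
    previous< = pred-mono-≤ (u↑ (inject₁ i′) (F.suc i′) (s≤s (≤-reflexive (toℕ-inject₁ i′))))

-- Tileable half-hexagons have spread dents

module Necessity (a b n : ℕ) (u : Fin n → ℕ) (u≥1 : ∀ i → 1 ≤ u i) (u≤ : ∀ i → u i ≤ b + 2 * n)
                 (u↑ : Increasing u) (ls : List Loz) (ls⊆R : All (LozengeIn (HalfHexV a b n u)) ls)
                 (cov : ∀ τ → HalfHexV a b n u τ → coverCount τ ls ≡ 1) where

  c H : ℕ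
  c = a + n + b
  H = b + b + 2 * n

  private
    H≡[b+2n]+b : H ≡ b + 2 * n + b
    H≡[b+2n]+b = eq b n
      where
      eq : ∀ b n → b + b + 2 * n ≡ b + 2 * n + b
      eq = solve-∀
    H≡double : H ≡ double (b + n)
    H≡double = trans (eq b n) (sym (double≡ (b + n)))
      where
      eq : ∀ b n → b + b + 2 * n ≡ b + n + (b + n)
      eq = solve-∀
    H≤2c : H ≤ 2 * c
    H≤2c = +≡⇒≤ (2 * a) (eq a n b)
      where
      eq : ∀ a n b → b + b + 2 * n + 2 * a ≡ 2 * (a + n + b)
      eq = solve-∀

  open TiledRows b c H (DentRow n u H) (λ y → any? (λ i → y + u i ≟ H))
                 (m≤n+m b (a + n)) H≤2c (≤-trans (m≤m+n b b) (m≤m+n (b + b) (2 * n))) ls ls⊆R cov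

  u≤H : ∀ j → u j ≤ H
  u≤H j = ≤-trans (u≤ j) (subst (b + 2 * n ≤_) (sym H≡[b+2n]+b) (m≤m+n (b + 2 * n) b))

  row[pred[u]]≡H∸u : ∀ j → row H (pred (u j)) ≡ H ∸ u j
  row[pred[u]]≡H∸u j with u j | u≥1 j
  ... | suc _ | _ = refl

  Σtop-evenInd-all : Σtop H evenInd ≡ b + n
  Σtop-evenInd-all = subst (λ h → Σ< h (λ s → evenInd (row h s)) ≡ b + n) (sym H≡double) (Σ-evenInd-all-rows (b + n))

  2*Σtop-evenInd≤ : ∀ k → k ≤ H → 2 * Σtop k evenInd ≤ k
  2*Σtop-evenInd≤ k k≤H = subst (λ h → 2 * Σ< k (λ s → evenInd (row h s)) ≤ k) (sym H≡double)
    (Σ-evenInd-top-rows (b + n) k (subst (k ≤_) H≡double k≤H))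

  Σtop-belowB≤b : Σtop H belowB ≤ b
  Σtop-belowB≤b = begin
      Σtop H belowB
    ≡⟨ cong (λ h → Σtop h belowB) H≡[b+2n]+b ⟩
      Σtop (b + 2 * n + b) belowB
    ≡⟨ Σ<-split (b + 2 * n) b (belowB ∘ row H) ⟩
      Σtop (b + 2 * n) belowB + Σ< b (λ x → belowB (row H (b + 2 * n + x)))
    ≡⟨ cong (_+ Σ< b (λ x → belowB (row H (b + 2 * n + x)))) (Σ<≡0 (b + 2 * n) (belowB ∘ row H) upper-rows) ⟩
      Σ< b (λ x → belowB (row H (b + 2 * n + x)))
    ≤⟨ Σ<-≤-length b _ (λ x _ → χ≤1 (suc (row H (b + 2 * n + x)) ≤? b)) ⟩
      b
    ∎
    where
    open ≤-Reasoning
    H∸[b+2n]≡b : H ∸ (b + 2 * n) ≡ b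
    H∸[b+2n]≡b = trans (cong (_∸ (b + 2 * n)) (trans H≡[b+2n]+b (+-comm (b + 2 * n) b))) (m+n∸n≡m b (b + 2 * n))
    upper-rows : ∀ s → s < b + 2 * n → belowB (row H s) ≡ 0
    upper-rows s s<b+2n = χ-no (suc (row H s) ≤? b) λ below →
      n≮n (row H s) (≤-trans below (subst (_≤ row H s) H∸[b+2n]≡b (∸-monoʳ-≤ H s<b+2n)))

  n≤Σtop-dentInd : n ≤ Σtop H dentInd
  n≤Σtop-dentInd = +-cancelˡ-≤ b _ _ (begin
      b + n
    ≡⟨ sym Σtop-evenInd-all ⟩
      Σtop H evenInd
    ≤⟨ all-rows-bound ⟩
      Σtop H dentInd + Σtop H belowB
    ≤⟨ +-monoʳ-≤ (Σtop H dentInd) Σtop-belowB≤b ⟩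
      Σtop H dentInd + b
    ≡⟨ +-comm (Σtop H dentInd) b ⟩
      b + Σtop H dentInd
    ∎)
    where open ≤-Reasoning

  -- Otherwise the rows counted by dentInd, together with the row of dent j, would exceed
  -- the n dent rows.
  dent-inside : ∀ j → DentIn (H ∸ u j)
  dent-inside j = decide (DentIn? (H ∸ u j))
    where
    hits-j : ℕ → ℕ
    hits-j s = χ (row H s + u j ≟ H)
    1≤Σ-hits-j : 1 ≤ Σ< H hits-j
    1≤Σ-hits-j = ≤-trans (≤-reflexive (sym (χ-yes (row H (pred (u j)) + u j ≟ H) row-of-j)))
                         (term≤Σ< H hits-j (pred (u j)) pred[u]<H)
      where
      pred[u]<H : pred (u j) < H
      pred[u]<H with u j | u≥1 j | u≤H j
      ... | suc _ | _ | u≤H = u≤H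
      row-of-j : row H (pred (u j)) + u j ≡ H
      row-of-j = trans (cong (_+ u j) (row[pred[u]]≡H∸u j)) (m∸n+n≡m (u≤H j))
    decide : Dec (DentIn (H ∸ u j)) → DentIn (H ∸ u j)
    decide (yes inside) = inside
    decide (no outside) = ⊥-elim (1+n≰n (begin
        suc n
      ≤⟨ +-mono-≤ 1≤Σ-hits-j n≤Σtop-dentInd ⟩
        Σ< H hits-j + Σtop H dentInd
      ≡⟨ trans (+-comm (Σ< H hits-j) _) (sym (Σ<-+ H _ _)) ⟩
        Σ< H (λ s → dentInd (row H s) + hits-j s)
      ≤⟨ Σ<-mono H (λ s _ → χ-disjoint-≤ proj₁ (j ,_) (λ inside e → outside (subst DentIn (row≡ e) inside))
                                           (DentIn? (row H s)) (row H s + u j ≟ H) (any? (λ i → row H s + u i ≟ H))) ⟩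
        Σ< H (λ s → χ (any? (λ i → row H s + u i ≟ H)))
      ≤⟨ dent-rows≤ H H ≤-refl n u (λ s → any? (λ i → row H s + u i ≟ H)) ⟩
        n
      ∎))
      where
      open ≤-Reasoning
      row≡ : ∀ {y} → y + u j ≡ H → y ≡ H ∸ u j
      row≡ {y} e = trans (sym (m+n∸n≡m y (u j))) (cong (_∸ u j) e)

  spread : Spread u
  spread i = begin
      2 * suc (toℕ i)
    ≤⟨ *-monoʳ-≤ 2 (Increasing⇒hits≤Σ< u (dentInd ∘ row H) u↑ u≥1 dent-hit i) ⟩
      2 * Σtop (u i) dentInd
    ≤⟨ *-monoʳ-≤ 2 (≤-trans (m≤m+n (Σtop (u i) dentInd) (Σtop (u i) belowB)) (top-rows-bound (u i) (u≤H i))) ⟩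
      2 * Σtop (u i) evenInd
    ≤⟨ 2*Σtop-evenInd≤ (u i) (u≤H i) ⟩
      u i
    ∎
    where
    open ≤-Reasoning
    dent-hit : ∀ j → 1 ≤ dentInd (row H (pred (u j)))
    dent-hit j = ≤-reflexive (sym (χ-yes (DentIn? _) (subst DentIn (sym (row[pred[u]]≡H∸u j)) (dent-inside j))))

V-tiling⇒Spread : ∀ a b n (u : Fin n → ℕ) → ValidDents n (b + 2 * n) u → LozengeTiling (V a b n u) → Spread u
V-tiling⇒Spread a b n u (u≥1 , u≤ , u↑) tiling =
  spread (tiling-resp (V⇒HalfHexV a b n u) (HalfHexV⇒V a b n u u≥1) tiling)
  where
  spread : LozengeTiling (HalfHexV a b n u) → Spread u
  spread (ls , ls⊆R , cov) = Necessity.spread a b n u u≥1 u≤ u↑ ls ls⊆R cov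

Spread⇒V-tiling : ∀ a b n (u : Fin n → ℕ) → ValidDents n (b + 2 * n) u → Spread u → LozengeTiling (V a b n u)
Spread⇒V-tiling a b n u (u≥1 , u≤ , u↑) spread =
  tiling-resp (HalfHexV⇒V a b n u u≥1) (V⇒HalfHexV a b n u) (Spread⇒tiling n u a b u≤ u↑ spread)

mainTheorem3 : (a a' b b' n : ℕ) (u u' : Fin n → ℕ) →
    ValidDents n (b + 2 * n) u → ValidDents n (b' + 2 * n) u' →
    (∀ i → u i ≤ u' i) →
    LozengeTiling (V a b n u) → LozengeTiling (V a' b' n u')
mainTheorem3 a a' b b' n u u' valid valid' u≤u' tiling =
  Spread⇒V-tiling a' b' n u' valid' (λ i → ≤-trans (V-tiling⇒Spread a b n u valid tiling i) (u≤u' i))
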